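{- Let $\mathbf{M}$ be a finite field and let $\mathbf{K}$ be a subfield of $\mathbf{M}$ such that the degree $[\mathbf{M}:\mathbf{K}]$ is a prime power. Let $\alpha$ be a generator of $\mathbf{M}$ over $\mathbf{K}$, i.e. $\mathbf{K}(\alpha)=\mathbf{M}$. Let $\mathbf{L}$ be a subfield of $\mathbf{M}$ containing $\mathbf{K}$, and let $d=[\mathbf{M}:\mathbf{L}]$. Let $(\Sigma_k)_{1\leqslant k\leqslant d}$ be the $d$ symmetric functions of $\alpha$ over $\mathbf{L}$, i.e. the coefficients of the characteristic polynomial of $\alpha$ viewed as an element of the $\mathbf{L}$-algebra $\mathbf{M}$. Then at least one of $\Sigma_1,\dots,\Sigma_d$ generates $\mathbf{L}$ over $\mathbf{K}$, i.e. $\mathbf{K}(\Sigma_k)=\mathbf{L}$ for some $k$. -}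

module Defs where

open import Level using (Level; _⊔_; suc; Lift)
open import Algebra.Bundles using (CommutativeRing)
open import Data.Nat as ℕ using (ℕ; zero; _∸_; _^_)
import Data.Nat as Nat
open import Data.Nat.Primality using (Prime)
open import Data.Fin as Fin using (Fin; toℕ; punchIn)
open import Data.List using (List; []; _∷_)
open import Data.List.Relation.Unary.Any using (Any)
open import Data.Product using (Σ; ∃; _×_; _,_)
open import Data.Unit.Polymorphic using (⊤)
open import Relation.Nullary using (¬_; yes; no)
open import Relation.Binary.Definitions using (Decidable)
open import Relation.Binary.PropositionalEquality using (_≡_)
open import Relation.Unary using (Pred; _∈_; _⊆_)

record FiniteField (c ℓ : Level) : Set (suc (c ⊔ ℓ)) where
  field
    commutativeRing : CommutativeRing c ℓ
  open CommutativeRing commutativeRing public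
  field
    _≟_         : Decidable _≈_
    0≉1         : ¬ (0# ≈ 1#)
    inverse     : ∀ x → ¬ (x ≈ 0#) → ∃ λ y → x * y ≈ 1#
    enumeration : ∃ λ (xs : List Carrier) → ∀ x → Any (x ≈_) xs

module Over {c ℓ : Level} (F : FiniteField c ℓ) where
  open FiniteField F

  record IsSubfield (S : Pred Carrier ℓ) : Set (c ⊔ ℓ) where
    field
      resp  : ∀ {x y} → x ≈ y → x ∈ S → y ∈ S
      zero∈ : 0# ∈ S
      one∈  : 1# ∈ S
      +∈    : ∀ {x y} → x ∈ S → y ∈ S → (x + y) ∈ S
      neg∈  : ∀ {x} → x ∈ S → (- x) ∈ S
      *∈    : ∀ {x y} → x ∈ S → y ∈ S → (x * y) ∈ S
      inv∈  : ∀ {x y} → x ∈ S → x * y ≈ 1# → y ∈ S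

  Whole : Pred Carrier ℓ
  Whole _ = ⊤

  Generates : Pred Carrier ℓ → Carrier → Pred Carrier ℓ → Set (c ⊔ suc ℓ)
  Generates K β S =
    IsSubfield S × K ⊆ S × β ∈ S ×
    (∀ (T : Pred Carrier ℓ) → IsSubfield T → K ⊆ T → β ∈ T → S ⊆ T)

  sumF : ∀ {n} → (Fin n → Carrier) → Carrier
  sumF {zero}    f = 0#
  sumF {Nat.suc n} f = f Fin.zero + sumF (λ i → f (Fin.suc i))

  IsBasis : (S : Pred Carrier ℓ) → {n : ℕ} → (Fin n → Carrier) → Set (c ⊔ ℓ)
  IsBasis S {n} b =
    (∀ x → ∃ λ (a : Fin n → Carrier) → (∀ i → a i ∈ S) × x ≈ sumF (λ i → a i * b i)) ×
    (∀ (a : Fin n → Carrier) → (∀ i → a i ∈ S) → sumF (λ i → a i * b i) ≈ 0# → ∀ i → a i ≈ 0#)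

  HasDegree : Pred Carrier ℓ → ℕ → Set (c ⊔ ℓ)
  HasDegree S n = Σ (Fin n → Carrier) (IsBasis S)

  IsPrimePower : ℕ → Set
  IsPrimePower n = ∃ λ p → ∃ λ k → Prime p × n ≡ p ^ k

  IsMulMatrix : (S : Pred Carrier ℓ) → {n : ℕ} → (Fin n → Carrier) → Carrier →
                (Fin n → Fin n → Carrier) → Set ℓ
  IsMulMatrix S b α A =
    (∀ i j → A i j ∈ S) × (∀ j → α * b j ≈ sumF (λ i → A i j * b i))

  -- polynomials as coefficient lists (lowest degree first)
  Poly : Set c
  Poly = List Carrier

  _+P_ : Poly → Poly → Poly
  []       +P q        = q
  p        +P []       = p
  (a ∷ p)  +P (b ∷ q)  = (a + b) ∷ (p +P q)

  scaleP : Carrier → Poly → Poly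
  scaleP a []      = []
  scaleP a (b ∷ p) = (a * b) ∷ scaleP a p

  _*P_ : Poly → Poly → Poly
  []      *P q = []
  (a ∷ p) *P q = scaleP a q +P (0# ∷ (p *P q))

  negP : Poly → Poly
  negP = scaleP (- 1#)

  constP : Carrier → Poly
  constP a = a ∷ []

  Xp : Poly
  Xp = 0# ∷ 1# ∷ []

  coeff : ℕ → Poly → Carrier
  coeff _           []      = 0#
  coeff zero        (a ∷ p) = a
  coeff (Nat.suc k) (a ∷ p) = coeff k p

  sumP : ∀ {n} → (Fin n → Poly) → Poly
  sumP {zero}      f = []
  sumP {Nat.suc n} f = f Fin.zero +P sumP (λ i → f (Fin.suc i))

  signP : ℕ → Poly → Poly
  signP zero        p = p
  signP (Nat.suc k) p = negP (signP k p)

  det : ∀ n → (Fin n → Fin n → Poly) → Poly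
  det zero        m = constP 1#
  det (Nat.suc n) m =
    sumP (λ j → signP (toℕ j) (m Fin.zero j *P det n (λ i k → m (Fin.suc i) (punchIn j k))))

  charPoly : ∀ {n} → (Fin n → Fin n → Carrier) → Poly
  charPoly {n} A = det n (λ i j → diag i j +P negP (constP (A i j)))
    where
    diag : Fin n → Fin n → Poly
    diag i j with i Fin.≟ j
    ... | yes _ = Xp
    ... | no  _ = []

  sign : ℕ → Carrier → Carrier
  sign zero        x = x
  sign (Nat.suc k) x = - (sign k x)

  symFun : ∀ {n} → (Fin n → Fin n → Carrier) → ℕ → Carrier
  symFun {n} A k = sign k (coeff (n ∸ k) (charPoly A))

module Submission where

-- Let F = K(Σₖ) be maximal among K(Σ₁), …, K(Σ_d). As [M : K] is a prime power, the fields between K and M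
-- have orders |K| ^ (p ^ i) and form a chain, so F contains every Σᵢ, while F ⊆ L because every Σᵢ lies in L.
-- The characteristic polynomial of α is monic of degree d with coefficients ±Σᵢ in F, so M = K(α) ⊆ F(α) is
-- spanned over F by 1, α, …, α ^ (d − 1): |L| ^ d = |M| ≤ |F| ^ d. Hence |L| ≤ |F| and F = L.

open import Defs
open import Level using (Level; _⊔_) renaming (suc to lsuc)
open import Algebra.Bundles using (CommutativeRing)
import Algebra.Solver.Ring
open import Algebra.Solver.Ring.AlmostCommutativeRing using (fromCommutativeRing; _-Raw-AlmostCommutative⟶_)
open import Data.Bool using (if_then_else_)
open import Data.Empty.Polymorphic using (⊥)
open import Data.Fin as Fin using (Fin; toℕ; punchIn; inject₁)
import Data.Fin.Properties as Fin
open import Data.Integer as ℤ using (ℤ; +_; -[1+_]; +0; +[1+_]; _⊖_; _◃_)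
import Data.Integer.Properties as ℤ
open import Data.List as List using (List; []; _∷_; length; _∷ʳ′_)
import Data.List.Properties as ListP
open import Data.List.Membership.Propositional using (find)
import Data.List.Membership.Setoid
import Data.List.Membership.Setoid.Properties as ∈
open import Data.List.Relation.Binary.Pointwise using ([]; _∷_)
import Data.List.Relation.Binary.Equality.Setoid
open import Data.List.Relation.Unary.All as All using (All; []; _∷_)
import Data.List.Relation.Unary.All.Properties as All
import Data.List.Relation.Unary.All.Properties.Core as All
open import Data.List.Relation.Unary.AllPairs as AllPairs using (AllPairs; []; _∷_)
import Data.List.Relation.Unary.AllPairs.Properties as AllPairs
open import Data.List.Relation.Unary.Any as Any using (here; there)
import Data.List.Relation.Unary.Any.Properties as Any
import Data.List.Relation.Unary.Enumerates.Setoid.Properties as IsEnumeration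
import Data.List.Relation.Unary.Unique.Setoid
import Data.List.Relation.Unary.Unique.Setoid.Properties as Unique
import Data.List.Relation.Unary.Unique.DecSetoid.Properties as Unique
open import Data.Maybe as Maybe using (Maybe)
open import Data.Nat as ℕ using (ℕ; zero; suc; _≤_; _<_; _∸_; z≤n; s≤s)
import Data.Nat.Properties as ℕ
open import Algebra.Properties.CommutativeSemigroup ℕ.*-commutativeSemigroup using (xy∙z≈xz∙y)
open import Data.Nat.Divisibility using (divides)
open import Data.Nat.Primality using (Prime; euclidsLemma; prime⇒nonZero)
open import Data.Product using (Σ; ∃; _×_; _,_; proj₁; proj₂)
import Data.Sign as Sign
open import Data.Sum using (_⊎_; inj₁; inj₂)
open import Data.Unit.Polymorphic using (⊤; tt)
open import Data.Vec.Functional using (updateAt)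
open import Data.Vec.Functional.Properties
  using (updateAt-updates; updateAt-minimal; updateAt-id-local; updateAt-commutes; map-updateAt-local)
open import Function using (case_of_; _∘_; _$_; const)
open import Relation.Binary.Bundles using (DecSetoid)
open import Relation.Binary.Core using (Rel)
open import Relation.Binary.Definitions using (tri<; tri≈; tri>)
open import Relation.Binary.PropositionalEquality as ≡ using (_≡_; _≢_)
open import Relation.Nullary using (¬_; Dec; yes; no; ¬?; _×-dec_; _⊎-dec_; does; contradiction)
import Relation.Nullary.Decidable as Dec
open import Relation.Nullary.Decidable using (dec⇒maybe)
open import Relation.Unary using (Pred; _⊆_; Decidable)

^-injectiveʳ : ∀ q {m n} → 1 < q → q ℕ.^ m ≡ q ℕ.^ n → m ≡ n
^-injectiveʳ q {m} {n} 1<q eq with ℕ.<-cmp m n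
... | tri< m<n _ _ = contradiction eq (ℕ.<⇒≢ (ℕ.^-monoʳ-< q 1<q m<n))
... | tri≈ _ m≡n _ = m≡n
... | tri> _ _ n<m = contradiction (≡.sym eq) (ℕ.<⇒≢ (ℕ.^-monoʳ-< q 1<q n<m))

^-cancelʳ-≤ : ∀ n {a b} → a ℕ.^ suc n ≤ b ℕ.^ suc n → a ≤ b
^-cancelʳ-≤ n le = ℕ.≮⇒≥ (λ b<a → ℕ.<⇒≱ (ℕ.^-monoˡ-< (suc n) b<a) le)

n<2^n : ∀ n → n < 2 ℕ.^ n
n<2^n zero = s≤s z≤n
n<2^n (suc n) = ℕ.+-mono-≤ (ℕ.m^n>0 2 n) (ℕ.≤-trans (n<2^n n) (ℕ.m≤m+n (2 ℕ.^ n) 0))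

prime-power-divisor : ∀ {p} → Prime p → ∀ k a b → a ℕ.* b ≡ p ℕ.^ k → ∃ λ i → a ≡ p ℕ.^ i
prime-power-divisor p-prime zero a b ab≡1 = 0 , ℕ.m*n≡1⇒m≡1 a b ab≡1
prime-power-divisor {p} p-prime (suc k) a b ab≡p*p^k =
  case euclidsLemma a b p-prime (divides (p ℕ.^ k) ab≡p^k*p) of λ where
    (inj₁ (divides a′ ≡.refl)) →
      let i , a′≡p^i = prime-power-divisor p-prime k a′ b (cancel-p (≡.trans (xy∙z≈xz∙y a′ b p) ab≡p^k*p))
      in suc i , ≡.trans (≡.cong (ℕ._* p) a′≡p^i) (ℕ.*-comm (p ℕ.^ i) p)
    (inj₂ (divides b′ ≡.refl)) →
      prime-power-divisor p-prime k a b′ (cancel-p (≡.trans (ℕ.*-assoc a b′ p) ab≡p^k*p))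
  where
  ab≡p^k*p : a ℕ.* b ≡ p ℕ.^ k ℕ.* p
  ab≡p^k*p = ≡.trans ab≡p*p^k (ℕ.*-comm p (p ℕ.^ k))
  cancel-p : ∀ {x} → x ℕ.* p ≡ p ℕ.^ k ℕ.* p → x ≡ p ℕ.^ k
  cancel-p = ℕ.*-cancelʳ-≡ _ _ p {{prime⇒nonZero p-prime}}

^-^-split : ∀ q p {i j} → i ≤ j → q ℕ.^ (p ℕ.^ j) ≡ (q ℕ.^ (p ℕ.^ i)) ℕ.^ (p ℕ.^ (j ∸ i))
^-^-split q p {i} {j} i≤j = begin
  q ℕ.^ (p ℕ.^ j)                         ≡⟨ ≡.cong (λ m → q ℕ.^ (p ℕ.^ m)) (ℕ.m+[n∸m]≡n i≤j) ⟨
  q ℕ.^ (p ℕ.^ (i ℕ.+ (j ∸ i)))           ≡⟨ ≡.cong (q ℕ.^_) (ℕ.^-distribˡ-+-* p i (j ∸ i)) ⟩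
  q ℕ.^ (p ℕ.^ i ℕ.* p ℕ.^ (j ∸ i))       ≡⟨ ℕ.^-*-assoc q (p ℕ.^ i) _ ⟨
  (q ℕ.^ (p ℕ.^ i)) ℕ.^ (p ℕ.^ (j ∸ i))   ∎
  where open ≡.≡-Reasoning

length-cartesianProductWith : ∀ {a b c} {A : Set a} {B : Set b} {C : Set c} (f : A → B → C) xs ys →
                              length (List.cartesianProductWith f xs ys) ≡ length xs ℕ.* length ys
length-cartesianProductWith f [] ys = ≡.refl
length-cartesianProductWith f (x ∷ xs) ys = ≡.trans (ListP.length-++ (List.map (f x) ys))
  (≡.cong₂ ℕ._+_ (ListP.length-map (f x) ys) (length-cartesianProductWith f xs ys))

AllPairs-restrict : ∀ {a q r s} {A : Set a} {Q : Pred A q} {R : Rel A r} {S : Rel A s} {xs} →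
                    All Q xs → AllPairs R xs → (∀ {x y} → Q x → Q y → R x y → S x y) → AllPairs S xs
AllPairs-restrict [] [] _ = []
AllPairs-restrict (qx ∷ qxs) (rx ∷ rxs) f =
  All.zipWith (λ (qy , rxy) → f qx qy rxy) (qxs , rx) ∷ AllPairs-restrict qxs rxs f

punchIn-inject₁ : ∀ {m} (j k : Fin (suc m)) → toℕ j ≤ toℕ k → punchIn (inject₁ j) k ≡ Fin.suc k
punchIn-inject₁ Fin.zero k _ = ≡.refl
punchIn-inject₁ {suc m} (Fin.suc j) (Fin.suc k) (s≤s j≤k) = ≡.cong Fin.suc (punchIn-inject₁ j k j≤k)

punchIn-suc : ∀ {m} (j k : Fin (suc m)) → toℕ j ≤ toℕ k → punchIn (Fin.suc k) j ≡ inject₁ j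
punchIn-suc Fin.zero k _ = ≡.refl
punchIn-suc {suc m} (Fin.suc j) (Fin.suc k) (s≤s j≤k) = ≡.cong Fin.suc (punchIn-suc j k j≤k)

punchIn-punchIn : ∀ {m} (j k : Fin (suc m)) → toℕ j ≤ toℕ k →
                  ∀ l → punchIn (inject₁ j) (punchIn k l) ≡ punchIn (Fin.suc k) (punchIn j l)
punchIn-punchIn Fin.zero k _ l = ≡.refl
punchIn-punchIn {suc m} (Fin.suc j) (Fin.suc k) (s≤s j≤k) Fin.zero = ≡.refl
punchIn-punchIn {suc m} (Fin.suc j) (Fin.suc k) (s≤s j≤k) (Fin.suc l) = ≡.cong Fin.suc (punchIn-punchIn j k j≤k l)

complement-index : ∀ d j → j < d → Σ (Fin d) λ k → suc (toℕ k) ≡ d ∸ j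
complement-index d j j<d with d ∸ j | ℕ.m<n⇒0<n∸m j<d | ℕ.m∸n≤m d j
... | suc t | _ | 1+t≤d = Fin.fromℕ< 1+t≤d , ≡.cong suc (Fin.toℕ-fromℕ< 1+t≤d)

-- The ring solver of the library needs coefficients with decidable equality; ℤ maps into every commutative ring.
module IntegerCoefficientSolver {c ℓ : Level} (R : CommutativeRing c ℓ) where
  open CommutativeRing R
  open import Algebra.Properties.Ring ring using (-0#≈0#; -‿involutive; -‿+-comm; -‿distribˡ-*; -‿distribʳ-*)
  open import Algebra.Properties.Semiring.Mult semiring using (×-homo-+; ×1-homo-*) renaming (_×_ to _×ᵣ_)
  open import Algebra.Properties.CommutativeSemigroup +-commutativeSemigroup using (interchange)
  open import Relation.Binary.Reasoning.Setoid setoid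

  ⟦_⟧ℤ : ℤ → Carrier
  ⟦ + n ⟧ℤ = n ×ᵣ 1#
  ⟦ -[1+ n ] ⟧ℤ = - (suc n ×ᵣ 1#)

  x≈x-0 : ∀ x → x ≈ x - 0#
  x≈x-0 x = sym (trans (+-congˡ -0#≈0#) (+-identityʳ x))

  ⟦⊖⟧ : ∀ m n → ⟦ m ⊖ n ⟧ℤ ≈ m ×ᵣ 1# - n ×ᵣ 1#
  ⟦⊖⟧ zero zero = x≈x-0 0#
  ⟦⊖⟧ zero (suc n) = sym (+-identityˡ _)
  ⟦⊖⟧ (suc m) zero = x≈x-0 _
  ⟦⊖⟧ (suc m) (suc n) = begin
    ⟦ suc m ⊖ suc n ⟧ℤ                     ≡⟨ ≡.cong ⟦_⟧ℤ (ℤ.[1+m]⊖[1+n]≡m⊖n m n) ⟩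
    ⟦ m ⊖ n ⟧ℤ                             ≈⟨ ⟦⊖⟧ m n ⟩
    m ×ᵣ 1# - n ×ᵣ 1#                      ≈⟨ +-identityˡ _ ⟨
    0# + (m ×ᵣ 1# - n ×ᵣ 1#)               ≈⟨ +-congʳ (-‿inverseʳ 1#) ⟨
    (1# - 1#) + (m ×ᵣ 1# - n ×ᵣ 1#)        ≈⟨ interchange 1# (- 1#) (m ×ᵣ 1#) (- (n ×ᵣ 1#)) ⟩
    (1# + m ×ᵣ 1#) + (- 1# - n ×ᵣ 1#)      ≈⟨ +-congˡ (-‿+-comm 1# (n ×ᵣ 1#)) ⟩
    suc m ×ᵣ 1# - suc n ×ᵣ 1#              ∎

  ⟦+⟧ : ∀ i j → ⟦ i ℤ.+ j ⟧ℤ ≈ ⟦ i ⟧ℤ + ⟦ j ⟧ℤ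
  ⟦+⟧ -[1+ m ] -[1+ n ] = sym (trans (-‿+-comm _ _) (-‿cong (trans (sym (×-homo-+ 1# (suc m) (suc n)))
    (reflexive (≡.cong (λ k → suc k ×ᵣ 1#) (ℕ.+-suc m n))))))
  ⟦+⟧ -[1+ m ] (+ n) = trans (⟦⊖⟧ n (suc m)) (+-comm _ _)
  ⟦+⟧ (+ m) -[1+ n ] = ⟦⊖⟧ m (suc n)
  ⟦+⟧ (+ m) (+ n) = ×-homo-+ 1# m n

  ⟦+◃⟧ : ∀ n → ⟦ Sign.+ ◃ n ⟧ℤ ≈ n ×ᵣ 1#
  ⟦+◃⟧ zero = refl
  ⟦+◃⟧ (suc n) = refl

  ⟦-◃⟧ : ∀ n → ⟦ Sign.- ◃ n ⟧ℤ ≈ - (n ×ᵣ 1#)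
  ⟦-◃⟧ zero = sym -0#≈0#
  ⟦-◃⟧ (suc n) = refl

  ⟦*⟧ : ∀ i j → ⟦ i ℤ.* j ⟧ℤ ≈ ⟦ i ⟧ℤ * ⟦ j ⟧ℤ
  ⟦*⟧ (+ m) (+ n) = trans (⟦+◃⟧ (m ℕ.* n)) (×1-homo-* m n)
  ⟦*⟧ (+ m) -[1+ n ] = trans (⟦-◃⟧ (m ℕ.* suc n)) (trans (-‿cong (×1-homo-* m (suc n))) (-‿distribʳ-* _ _))
  ⟦*⟧ -[1+ m ] (+ n) = trans (⟦-◃⟧ (suc m ℕ.* n)) (trans (-‿cong (×1-homo-* (suc m) n)) (-‿distribˡ-* _ _))
  ⟦*⟧ -[1+ m ] -[1+ n ] = trans (⟦+◃⟧ (suc m ℕ.* suc n)) (begin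
    (suc m ℕ.* suc n) ×ᵣ 1#   ≈⟨ ×1-homo-* (suc m) (suc n) ⟩
    a * b                     ≈⟨ -‿involutive (a * b) ⟨
    - - (a * b)               ≈⟨ -‿cong (-‿distribˡ-* a b) ⟩
    - (- a * b)               ≈⟨ -‿distribʳ-* (- a) b ⟩
    - a * - b                 ∎)
    where
    a b : Carrier
    a = suc m ×ᵣ 1#
    b = suc n ×ᵣ 1#

  ⟦-⟧ : ∀ i → ⟦ ℤ.- i ⟧ℤ ≈ - ⟦ i ⟧ℤ
  ⟦-⟧ +0 = sym -0#≈0#
  ⟦-⟧ +[1+ n ] = refl
  ⟦-⟧ -[1+ n ] = sym (-‿involutive _)

  ℤ⟶R : ℤ.+-*-rawRing -Raw-AlmostCommutative⟶ fromCommutativeRing R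
  ℤ⟶R = record
    { ⟦_⟧ = ⟦_⟧ℤ ; +-homo = ⟦+⟧ ; *-homo = ⟦*⟧ ; -‿homo = ⟦-⟧
    ; 0-homo = refl ; 1-homo = +-identityʳ 1# }

  ⟦⟧ℤ-weaklyDecidable : ∀ i j → Maybe (⟦ i ⟧ℤ ≈ ⟦ j ⟧ℤ)
  ⟦⟧ℤ-weaklyDecidable i j = Maybe.map (λ i≡j → reflexive (≡.cong ⟦_⟧ℤ i≡j)) (dec⇒maybe (i ℤ.≟ j))

  open Algebra.Solver.Ring ℤ.+-*-rawRing (fromCommutativeRing R) ℤ⟶R ⟦⟧ℤ-weaklyDecidable public
    using (solve; _:=_; _:+_; _:*_; :-_; _:-_; con)

module FieldTheory {c ℓ : Level} (F : FiniteField c ℓ) where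
  open FiniteField F hiding (zero)
  open Over F
  open import Relation.Binary.Reasoning.Setoid setoid
  open IntegerCoefficientSolver commutativeRing using (solve; _:=_; _:+_; _:*_; :-_; _:-_; con; x≈x-0)
  open import Algebra.Properties.Ring ring
    using ( -0#≈0#; -‿involutive; +-inverseʳ-unique; -‿distribˡ-*; -‿distribʳ-*; -1*x≈-x
          ; x∙y⁻¹≈ε⇒x≈y; x≈y⇒x∙y⁻¹≈ε; +-cancelˡ; -‿+-comm)
  open import Algebra.Properties.CommutativeSemiring.Exp commutativeSemiring
    using (_^_; ^-congˡ; ^-assocʳ)
  open import Algebra.Properties.CommutativeSemigroup *-commutativeSemigroup using (x∙yz≈y∙xz) renaming (interchange to *-interchange)
  open import Algebra.Properties.CommutativeSemigroup +-commutativeSemigroup using () renaming (interchange to +-interchange)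
  open Data.List.Membership.Setoid setoid using (_∈_; _∉_; _─_)
  open Data.List.Relation.Unary.Unique.Setoid setoid using (Unique)
  open Data.List.Relation.Binary.Equality.Setoid setoid using (_≋_; ≋-setoid)
  open Data.List.Membership.Setoid ≋-setoid using () renaming (_∈_ to _∈≋_)
  open Data.List.Relation.Unary.Unique.Setoid ≋-setoid using () renaming (Unique to Unique≋)

  1≉0 : 1# ≉ 0#
  1≉0 1≈0 = 0≉1 (sym 1≈0)

  x*y≈0⇒y≈0 : ∀ {x y} → x ≉ 0# → x * y ≈ 0# → y ≈ 0#
  x*y≈0⇒y≈0 {x} {y} x≉0 xy≈0 = let x⁻¹ , xx⁻¹≈1 = inverse x x≉0 in begin
    y               ≈⟨ sym (*-identityˡ y) ⟩
    1# * y          ≈⟨ *-congʳ (trans (sym xx⁻¹≈1) (*-comm x x⁻¹)) ⟩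
    (x⁻¹ * x) * y   ≈⟨ *-assoc x⁻¹ x y ⟩
    x⁻¹ * (x * y)   ≈⟨ *-congˡ xy≈0 ⟩
    x⁻¹ * 0#        ≈⟨ zeroʳ x⁻¹ ⟩
    0#              ∎

  *-≉0 : ∀ {x y} → x ≉ 0# → y ≉ 0# → x * y ≉ 0#
  *-≉0 x≉0 y≉0 xy≈0 = y≉0 (x*y≈0⇒y≈0 x≉0 xy≈0)

  *-cancelˡ-≉0 : ∀ {x a b} → x ≉ 0# → x * a ≈ x * b → a ≈ b
  *-cancelˡ-≉0 {x} {a} {b} x≉0 xa≈xb = x∙y⁻¹≈ε⇒x≈y a b (x*y≈0⇒y≈0 x≉0 (begin
    x * (a - b)       ≈⟨ solve 3 (λ x a b → x :* (a :- b) := x :* a :- x :* b) refl x a b ⟩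
    x * a - x * b     ≈⟨ x≈y⇒x∙y⁻¹≈ε xa≈xb ⟩
    0#                ∎))

  -- Counting elements of decidable subsets

  ∏ : List Carrier → Carrier
  ∏ = List.foldr _*_ 1#

  ∉×∈⇒≉ : ∀ {x y xs} → All (y ≉_) xs → x ∈ xs → x ≉ y
  ∉×∈⇒≉ y≉xs x∈xs x≈y = ∈.All[≉]⇒∉ setoid y≉xs (∈.∈-resp-≈ setoid x≈y x∈xs)

  length-─ : ∀ {y} xs (y∈xs : y ∈ xs) → length xs ≡ suc (length (xs ─ y∈xs))
  length-─ (x ∷ xs) (here _) = ≡.refl
  length-─ (x ∷ xs) (there y∈xs) = ≡.cong suc (length-─ xs y∈xs)

  ∈-─ : ∀ {y z} xs (y∈xs : y ∈ xs) → z ∈ xs → z ≉ y → z ∈ xs ─ y∈xs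
  ∈-─ (x ∷ xs) (here y≈x) (here z≈x) z≉y = contradiction (trans z≈x (sym y≈x)) z≉y
  ∈-─ (x ∷ xs) (here _) (there z∈xs) _ = z∈xs
  ∈-─ (x ∷ xs) (there _) (here z≈x) _ = here z≈x
  ∈-─ (x ∷ xs) (there y∈xs) (there z∈xs) z≉y = there (∈-─ xs y∈xs z∈xs z≉y)

  ∏-─ : ∀ {y} xs (y∈xs : y ∈ xs) → ∏ xs ≈ y * ∏ (xs ─ y∈xs)
  ∏-─ (x ∷ xs) (here y≈x) = *-congʳ (sym y≈x)
  ∏-─ {y} (x ∷ xs) (there y∈xs) = trans (*-congˡ (∏-─ xs y∈xs)) (x∙yz≈y∙xz x y _)

  unique-⊆⇒length-≤ : ∀ xs ys → Unique xs → (∀ {z} → z ∈ xs → z ∈ ys) → length xs ≤ length ys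
  unique-⊆⇒length-≤ [] ys _ _ = z≤n
  unique-⊆⇒length-≤ (x ∷ xs) ys (x≉xs ∷ xs!) xs⊆ys = ℕ.≤-trans
    (s≤s (unique-⊆⇒length-≤ xs (ys ─ x∈ys) xs! (λ z∈xs →
      ∈-─ ys x∈ys (xs⊆ys (there z∈xs)) (∉×∈⇒≉ x≉xs z∈xs))))
    (ℕ.≤-reflexive (≡.sym (length-─ ys x∈ys)))
    where
    x∈ys : x ∈ ys
    x∈ys = xs⊆ys (here refl)

  ∏-unique-⊇ : ∀ xs ys → Unique ys → (∀ {z} → z ∈ ys → z ∈ xs) → length xs ≡ length ys → ∏ xs ≈ ∏ ys
  ∏-unique-⊇ [] [] _ _ _ = refl
  ∏-unique-⊇ xs (y ∷ ys) (y≉ys ∷ ys!) ys⊆xs |xs|≡|ys| = trans (∏-─ xs y∈xs) (*-congˡ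
    (∏-unique-⊇ (xs ─ y∈xs) ys ys! (λ z∈ys → ∈-─ xs y∈xs (ys⊆xs (there z∈ys)) (∉×∈⇒≉ y≉ys z∈ys))
      (ℕ.suc-injective (≡.trans (≡.sym (length-─ xs y∈xs)) |xs|≡|ys|))))
    where
    y∈xs : y ∈ xs
    y∈xs = ys⊆xs (here refl)

  decSetoid : DecSetoid c ℓ
  decSetoid = record { isDecEquivalence = record { isEquivalence = isEquivalence ; _≟_ = _≟_ } }

  elements : List Carrier
  elements = List.deduplicate _≟_ (proj₁ enumeration)

  ∈-elements : ∀ x → x ∈ elements
  ∈-elements = IsEnumeration.deduplicate⁺ decSetoid (proj₂ enumeration)

  elements-unique : Unique elements
  elements-unique = Unique.deduplicate-! decSetoid (proj₁ enumeration)

  record DecSubset : Set (c ⊔ lsuc ℓ) where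
    field
      P    : Pred Carrier ℓ
      P?   : Decidable P
      resp : ∀ {x y} → x ≈ y → P x → P y

  open DecSubset

  module _ (D : DecSubset) where
    members : List Carrier
    members = List.filter (P? D) elements

    ∣_∣ : ℕ
    ∣_∣ = length members

    members-unique : Unique members
    members-unique = Unique.filter⁺ setoid (P? D) elements-unique

    ∈-members : ∀ {x} → P D x → x ∈ members
    ∈-members {x} = ∈.∈-filter⁺ setoid (P? D) (resp D) (∈-elements x)

    members-P : ∀ {x} → x ∈ members → P D x
    members-P x∈ = proj₂ (∈.∈-filter⁻ setoid (P? D) (resp D) {xs = elements} x∈)

    length≤∣∣ : ∀ xs → Unique xs → (∀ {x} → x ∈ xs → P D x) → length xs ≤ ∣_∣
    length≤∣∣ xs xs! xs⊆D = unique-⊆⇒length-≤ xs members xs! (λ x∈xs → ∈-members (xs⊆D x∈xs))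

    ∣∣≤length : ∀ xs → (∀ {x} → P D x → x ∈ xs) → ∣_∣ ≤ length xs
    ∣∣≤length xs D⊆xs = unique-⊆⇒length-≤ members xs members-unique (λ x∈ → D⊆xs (members-P x∈))

    length≡∣∣ : ∀ xs → Unique xs → (∀ {x} → x ∈ xs → P D x) → (∀ {x} → P D x → x ∈ xs) → length xs ≡ ∣_∣
    length≡∣∣ xs xs! xs⊆D D⊆xs = ℕ.≤-antisym (length≤∣∣ xs xs! xs⊆D) (∣∣≤length xs D⊆xs)

  _⊆ᴰ_ : DecSubset → DecSubset → Set (c ⊔ ℓ)
  D ⊆ᴰ E = P D ⊆ P E

  ∣∣-mono : ∀ {D E} → D ⊆ᴰ E → ∣ D ∣ ≤ ∣ E ∣
  ∣∣-mono {D} {E} D⊆E = length≤∣∣ E (members D) (members-unique D) (λ x∈ → D⊆E (members-P D x∈))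

  ⊆ᴰ∧∣∣≥⇒⊇ᴰ : ∀ {D E} → D ⊆ᴰ E → ∣ E ∣ ≤ ∣ D ∣ → E ⊆ᴰ D
  ⊆ᴰ∧∣∣≥⇒⊇ᴰ {D} {E} D⊆E ∣E∣≤∣D∣ {x} x∈E with P? D x
  ... | yes x∈D = x∈D
  ... | no x∉D = contradiction ∣E∣≤∣D∣ (ℕ.<⇒≱ (length≤∣∣ E (x ∷ members D)
          (∈.∉⇒All[≉] setoid (λ x∈D → x∉D (members-P D x∈D)) ∷ members-unique D)
          (λ { (here x′≈x) → resp E (sym x′≈x) x∈E ; (there y∈D) → D⊆E (members-P D y∈D) })))

  everything : DecSubset
  everything = record { P = λ _ → ⊤ ; P? = λ _ → yes tt ; resp = λ _ _ → tt }

  -- Fermat's little theorem for subfields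

  ∏-≉0 : ∀ {xs} → All (_≉ 0#) xs → ∏ xs ≉ 0#
  ∏-≉0 [] = 1≉0
  ∏-≉0 (x≉0 ∷ xs≉0) = *-≉0 x≉0 (∏-≉0 xs≉0)

  ∏-map-* : ∀ x es → ∏ (List.map (x *_) es) ≈ x ^ length es * ∏ es
  ∏-map-* x [] = sym (*-identityˡ 1#)
  ∏-map-* x (e ∷ es) = trans (*-congˡ (∏-map-* x es)) (*-interchange x e _ _)

  module SubfieldFermat (E : DecSubset) (E-subfield : IsSubfield (P E)) where
    open IsSubfield E-subfield using (zero∈; *∈)

    E* : DecSubset
    E* = record
      { P = λ x → P E x × x ≉ 0#
      ; P? = λ x → P? E x ×-dec ¬? (x ≟ 0#)
      ; resp = λ x≈y (x∈E , x≉0) → resp E x≈y x∈E , λ y≈0 → x≉0 (trans x≈y y≈0)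
      }

    ∣E∣≡1+∣E*∣ : ∣ E ∣ ≡ suc ∣ E* ∣
    ∣E∣≡1+∣E*∣ = ≡.sym (length≡∣∣ E (0# ∷ members E*)
      (∈.∉⇒All[≉] setoid (λ 0∈E* → proj₂ (members-P E* 0∈E*) refl) ∷ members-unique E*) ⊆E E⊆)
      where
      ⊆E : ∀ {x} → x ∈ 0# ∷ members E* → P E x
      ⊆E (here x≈0) = resp E (sym x≈0) zero∈
      ⊆E (there x∈E*) = proj₁ (members-P E* x∈E*)
      E⊆ : ∀ {x} → P E x → x ∈ 0# ∷ members E*
      E⊆ {x} x∈E with x ≟ 0#
      ... | yes x≈0 = here x≈0
      ... | no x≉0 = there (∈-members E* (x∈E , x≉0))

    -- Multiplication by x permutes E*, so x ^ ∣ E* ∣ * ∏ E* ≈ ∏ E*.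
    x^∣E*∣≈1 : ∀ {x} → P E x → x ≉ 0# → x ^ ∣ E* ∣ ≈ 1#
    x^∣E*∣≈1 {x} x∈E x≉0 = *-cancelˡ-≉0 (∏-≉0 es≉0) (begin
      ∏ es * x ^ ∣ E* ∣   ≈⟨ *-comm _ _ ⟩
      x ^ ∣ E* ∣ * ∏ es   ≈⟨ ∏-map-* x es ⟨
      ∏ xes               ≈⟨ ∏-unique-⊇ es xes xes-unique xes⊆es (≡.sym (ListP.length-map (x *_) es)) ⟨
      ∏ es                ≈⟨ *-identityʳ _ ⟨
      ∏ es * 1#           ∎)
      where
      es xes : List Carrier
      es = members E*
      xes = List.map (x *_) es
      es≉0 : All (_≉ 0#) es
      es≉0 = All.tabulateₛ setoid (λ e∈E* → proj₂ (members-P E* e∈E*))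
      xes-unique : Unique xes
      xes-unique = Unique.map⁺ setoid setoid (*-cancelˡ-≉0 x≉0) (members-unique E*)
      xes⊆es : ∀ {z} → z ∈ xes → z ∈ es
      xes⊆es z∈xes with ∈.∈-map⁻ setoid setoid z∈xes
      ... | e , e∈E* , z≈xe = let e∈E , e≉0 = members-P E* e∈E* in
        ∈-members E* (resp E (sym z≈xe) (*∈ x∈E e∈E) , λ z≈0 → *-≉0 x≉0 e≉0 (trans (sym z≈xe) z≈0))

    x^∣E∣≈x : ∀ {x} → P E x → x ^ ∣ E ∣ ≈ x
    x^∣E∣≈x {x} x∈E rewrite ∣E∣≡1+∣E*∣ with x ≟ 0#
    ... | yes x≈0 = trans (*-congʳ x≈0) (trans (zeroˡ _) (sym x≈0))
    ... | no x≉0 = trans (*-congˡ (x^∣E*∣≈1 x∈E x≉0)) (*-identityʳ x)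

  -- Roots of monic polynomials

  -- evalMonic cs evaluates the monic polynomial X ^ length cs + Σᵢ csᵢ Xⁱ.
  evalMonic : List Carrier → Carrier → Carrier
  evalMonic [] x = 1#
  evalMonic (a ∷ cs) x = a + x * evalMonic cs x

  divideMonic : List Carrier → Carrier → List Carrier
  divideMonic [] r = []
  divideMonic (a ∷ []) r = []
  divideMonic (a ∷ cs@(_ ∷ _)) r = evalMonic cs r ∷ divideMonic cs r

  length-divideMonic : ∀ a cs r → length (divideMonic (a ∷ cs) r) ≡ length cs
  length-divideMonic a [] r = ≡.refl
  length-divideMonic a (b ∷ cs) r = ≡.cong suc (length-divideMonic b cs r)

  evalMonic-divide : ∀ a cs r x →
    evalMonic (a ∷ cs) x ≈ (x - r) * evalMonic (divideMonic (a ∷ cs) r) x + evalMonic (a ∷ cs) r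
  evalMonic-divide a [] r x = begin
    a + x * 1#                      ≈⟨ +-congˡ (*-identityʳ x) ⟩
    a + x                           ≈⟨ solve 3 (λ a x r → a :+ x := (x :- r) :+ (a :+ r)) refl a x r ⟩
    (x - r) + (a + r)               ≈⟨ +-cong (*-identityʳ _) (+-congˡ (*-identityʳ r)) ⟨
    (x - r) * 1# + (a + r * 1#)     ∎
  evalMonic-divide a (b ∷ cs) r x = begin
    a + x * evalMonic (b ∷ cs) x      ≈⟨ +-congˡ (*-congˡ (evalMonic-divide b cs r x)) ⟩
    a + x * ((x - r) * q + e)         ≈⟨ solve 5 (λ a x r q e → a :+ x :* ((x :- r) :* q :+ e)
                                            := (x :- r) :* (e :+ x :* q) :+ (a :+ r :* e)) refl a x r q e ⟩
    (x - r) * (e + x * q) + (a + r * e) ∎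
    where
    q e : Carrier
    q = evalMonic (divideMonic (b ∷ cs) r) x
    e = evalMonic (b ∷ cs) r

  monic-roots-≤ : ∀ rs cs → Unique rs → (∀ {z} → z ∈ rs → evalMonic cs z ≈ 0#) → length rs ≤ length cs
  monic-roots-≤ [] cs _ _ = z≤n
  monic-roots-≤ (r ∷ rs) [] _ roots = contradiction (roots (here refl)) 1≉0
  monic-roots-≤ (r ∷ rs) (a ∷ cs) (r≉rs ∷ rs!) roots =
    s≤s (≡.subst (length rs ≤_) (length-divideMonic a cs r) (monic-roots-≤ rs (divideMonic (a ∷ cs) r) rs! quotient-roots))
    where
    quotient-roots : ∀ {z} → z ∈ rs → evalMonic (divideMonic (a ∷ cs) r) z ≈ 0#
    quotient-roots {z} z∈rs = x*y≈0⇒y≈0 (λ z-r≈0 → ∉×∈⇒≉ r≉rs z∈rs (x∙y⁻¹≈ε⇒x≈y z r z-r≈0)) (begin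
      (z - r) * evalMonic (divideMonic (a ∷ cs) r) z                           ≈⟨ +-identityʳ _ ⟨
      (z - r) * evalMonic (divideMonic (a ∷ cs) r) z + 0#                      ≈⟨ +-congˡ (roots (here refl)) ⟨
      (z - r) * evalMonic (divideMonic (a ∷ cs) r) z + evalMonic (a ∷ cs) r    ≈⟨ evalMonic-divide a cs r z ⟨
      evalMonic (a ∷ cs) z                                                     ≈⟨ roots (there z∈rs) ⟩
      0#                                                                       ∎)

  fixedPointPoly : ℕ → List Carrier
  fixedPointPoly k = 0# ∷ - 1# ∷ List.replicate k 0#

  length-fixedPointPoly : ∀ k → length (fixedPointPoly k) ≡ suc (suc k)
  length-fixedPointPoly k = ≡.cong (suc ∘ suc) (ListP.length-replicate k)

  evalMonic-fixedPointPoly : ∀ k x → evalMonic (fixedPointPoly k) x ≈ x ^ suc (suc k) - x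
  evalMonic-fixedPointPoly k x = begin
    0# + x * (- 1# + x * evalMonic (List.replicate k 0#) x)  ≈⟨ +-identityˡ _ ⟩
    x * (- 1# + x * evalMonic (List.replicate k 0#) x)       ≈⟨ *-congˡ (+-congˡ (*-congˡ (evalMonic-zeros k))) ⟩
    x * (- 1# + x * x ^ k)                                   ≈⟨ distribˡ x (- 1#) (x * x ^ k) ⟩
    x * - 1# + x * (x * x ^ k)                               ≈⟨ +-comm _ _ ⟩
    x * (x * x ^ k) + x * - 1#                               ≈⟨ +-congˡ (trans (*-comm x (- 1#)) (-1*x≈-x x)) ⟩
    x * (x * x ^ k) - x                                      ∎
    where
    evalMonic-zeros : ∀ n → evalMonic (List.replicate n 0#) x ≈ x ^ n
    evalMonic-zeros zero = refl
    evalMonic-zeros (suc n) = trans (+-identityˡ _) (*-congˡ (evalMonic-zeros n))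

  fixedPointPoly-closed : ∀ {S} → IsSubfield S → ∀ k → All S (fixedPointPoly k)
  fixedPointPoly-closed S-subfield k = zero∈ ∷ neg∈ one∈ ∷ All.replicate⁺ k zero∈
    where open IsSubfield S-subfield

  fixedPoints : ℕ → DecSubset
  fixedPoints N = record
    { P = λ x → x ^ N ≈ x
    ; P? = λ x → (x ^ N) ≟ x
    ; resp = λ x≈y x^N≈x → trans (sym (^-congˡ N x≈y)) (trans x^N≈x x≈y)
    }

  ∣fixedPoints∣≤ : ∀ N → 2 ≤ N → ∣ fixedPoints N ∣ ≤ N
  ∣fixedPoints∣≤ (suc zero) (s≤s ())
  ∣fixedPoints∣≤ (suc (suc k)) _ = ≡.subst (∣ roots ∣ ≤_) (length-fixedPointPoly k)
    (monic-roots-≤ (members roots) (fixedPointPoly k) (members-unique roots)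
      (λ z∈ → trans (evalMonic-fixedPointPoly k _) (x≈y⇒x∙y⁻¹≈ε (members-P roots z∈))))
    where
    roots : DecSubset
    roots = fixedPoints (suc (suc k))

  -- Dimension counting over a subfield

  order : ℕ
  order = ∣ everything ∣

  subfield-∣∣≥2 : ∀ D → IsSubfield (P D) → 2 ≤ ∣ D ∣
  subfield-∣∣≥2 D D-subfield = length≤∣∣ D (0# ∷ 1# ∷ []) ((0≉1 ∷ []) ∷ [] ∷ [])
    λ { (here x≈0) → resp D (sym x≈0) zero∈ ; (there (here x≈1)) → resp D (sym x≈1) one∈ }
    where open IsSubfield D-subfield

  tuples : List Carrier → ℕ → List (List Carrier)
  tuples xs zero = [] ∷ []
  tuples xs (suc n) = List.cartesianProductWith _∷_ xs (tuples xs n)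

  length-tuples : ∀ xs n → length (tuples xs n) ≡ length xs ℕ.^ n
  length-tuples xs zero = ≡.refl
  length-tuples xs (suc n) = ≡.trans (length-cartesianProductWith _∷_ xs (tuples xs n))
    (≡.cong (length xs ℕ.*_) (length-tuples xs n))

  tuples-All : ∀ {Q : Pred Carrier ℓ} {xs} n → All Q xs → All (λ t → length t ≡ n × All Q t) (tuples xs n)
  tuples-All zero _ = (≡.refl , []) ∷ []
  tuples-All {xs = xs} (suc n) Qxs = All.cartesianProductWith⁺ (≡.setoid _) (≡.setoid _) _∷_ xs (tuples xs n)
    (λ x∈xs t∈tuples → let |t|≡n , Qt = All.lookup (tuples-All n Qxs) t∈tuples
                       in ≡.cong suc |t|≡n , All.lookup Qxs x∈xs ∷ Qt)

  ∈-tuples : ∀ {xs} n t → length t ≡ n → All (_∈ xs) t → t ∈≋ tuples xs n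
  ∈-tuples zero [] _ [] = here []
  ∈-tuples (suc n) (a ∷ t) |t|≡n (a∈xs ∷ t⊆xs) = ∈.∈-cartesianProductWith⁺ setoid ≋-setoid ≋-setoid _∷_
    a∈xs (∈-tuples n t (ℕ.suc-injective |t|≡n) t⊆xs)

  tuples-unique : ∀ {xs} n → Unique xs → Unique≋ (tuples xs n)
  tuples-unique zero _ = [] ∷ []
  tuples-unique (suc n) xs! = Unique.cartesianProductWith⁺ setoid ≋-setoid ≋-setoid _∷_
    (λ { (x≈y ∷ xs≋ys) → x≈y , xs≋ys }) xs! (tuples-unique n xs!)

  lincomb : List Carrier → List Carrier → Carrier
  lincomb (a ∷ t) (v ∷ vs) = a * v + lincomb t vs
  lincomb _ _ = 0#

  lincomb-cong : ∀ {t t′} vs → t ≋ t′ → lincomb t vs ≈ lincomb t′ vs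
  lincomb-cong [] [] = refl
  lincomb-cong (v ∷ vs) [] = refl
  lincomb-cong [] (_ ∷ _) = refl
  lincomb-cong (v ∷ vs) (a≈b ∷ t≋t′) = +-cong (*-congʳ a≈b) (lincomb-cong vs t≋t′)

  lincomb-zipWith-difference : ∀ t t′ vs → length t ≡ length t′ →
                      lincomb (List.zipWith _-_ t t′) vs ≈ lincomb t vs - lincomb t′ vs
  lincomb-zipWith-difference [] [] vs _ = x≈x-0 0#
  lincomb-zipWith-difference (a ∷ t) (b ∷ t′) [] _ = x≈x-0 0#
  lincomb-zipWith-difference (a ∷ t) (b ∷ t′) (v ∷ vs) |t|≡|t′| = begin
    (a - b) * v + lincomb (List.zipWith _-_ t t′) vs
      ≈⟨ +-congˡ (lincomb-zipWith-difference t t′ vs (ℕ.suc-injective |t|≡|t′|)) ⟩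
    (a - b) * v + (lincomb t vs - lincomb t′ vs)      ≈⟨ solve 5 (λ a b v x y → (a :- b) :* v :+ (x :- y)
                                                           := (a :* v :+ x) :- (b :* v :+ y)) refl a b v _ _ ⟩
    (a * v + lincomb t vs) - (b * v + lincomb t′ vs)  ∎

  lincomb-map-*ˡ : ∀ a t vs → lincomb (List.map (a *_) t) vs ≈ a * lincomb t vs
  lincomb-map-*ˡ a [] vs = sym (zeroʳ a)
  lincomb-map-*ˡ a (b ∷ t) [] = sym (zeroʳ a)
  lincomb-map-*ˡ a (b ∷ t) (v ∷ vs) = trans (+-congˡ (lincomb-map-*ˡ a t vs))
    (solve 4 (λ a b v x → (a :* b) :* v :+ a :* x := a :* (b :* v :+ x)) refl a b v _)

  module Span (K : DecSubset) (K-subfield : IsSubfield (P K)) where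
    open IsSubfield K-subfield

    Coeffs : List Carrier → List Carrier → Set (c ⊔ ℓ)
    Coeffs vs t = length t ≡ length vs × All (P K) t

    span : List Carrier → List Carrier
    span vs = List.map (λ t → lincomb t vs) (tuples (members K) (length vs))

    Independent : List Carrier → Set (c ⊔ ℓ)
    Independent vs = ∀ {t t′} → Coeffs vs t → Coeffs vs t′ → lincomb t vs ≈ lincomb t′ vs → t ≋ t′

    tuples-Coeffs : ∀ vs → All (Coeffs vs) (tuples (members K) (length vs))
    tuples-Coeffs vs = tuples-All (length vs) (All.tabulateₛ setoid (members-P K))

    length-span : ∀ vs → length (span vs) ≡ ∣ K ∣ ℕ.^ length vs
    length-span vs = ≡.trans (ListP.length-map _ (tuples (members K) (length vs))) (length-tuples _ (length vs))

    ∈-span⁻ : ∀ {x} vs → x ∈ span vs → ∃ λ t → Coeffs vs t × x ≈ lincomb t vs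
    ∈-span⁻ vs x∈span = let t , t∈ , x≈ = find (Any.map⁻ x∈span) in t , All.lookup (tuples-Coeffs vs) t∈ , x≈

    ∈-span⁺ : ∀ {t} vs → Coeffs vs t → lincomb t vs ∈ span vs
    ∈-span⁺ {t} vs (|t|≡|vs| , t∈K) = ∈.∈-map⁺ ≋-setoid setoid (lincomb-cong vs)
      (∈-tuples (length vs) t |t|≡|vs| (All.map (∈-members K) t∈K))

    span-unique : ∀ vs → Independent vs → Unique (span vs)
    span-unique vs independent = AllPairs.map⁺ (AllPairs-restrict (tuples-Coeffs vs)
      (tuples-unique (length vs) (members-unique K)) (λ ct ct′ t≉t′ eq → t≉t′ (independent ct ct′ eq)))

    spanning⇒∣∣≤ : ∀ E vs → (∀ {x} → P E x → x ∈ span vs) → ∣ E ∣ ≤ ∣ K ∣ ℕ.^ length vs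
    spanning⇒∣∣≤ E vs E⊆span = ℕ.≤-trans (∣∣≤length E (span vs) E⊆span) (ℕ.≤-reflexive (length-span vs))

    basis⇒∣∣≡ : ∀ E vs → Independent vs → (∀ {x} → x ∈ span vs → P E x) → (∀ {x} → P E x → x ∈ span vs) →
                ∣ E ∣ ≡ ∣ K ∣ ℕ.^ length vs
    basis⇒∣∣≡ E vs independent span⊆E E⊆span =
      ≡.trans (≡.sym (length≡∣∣ E (span vs) (span-unique vs independent) span⊆E E⊆span)) (length-span vs)

  module Dimension (K : DecSubset) (K-subfield : IsSubfield (P K)) (E : DecSubset) (E-subfield : IsSubfield (P E))
                   (K⊆E : K ⊆ᴰ E) where
    open Span K K-subfield
    open IsSubfield K-subfield using (+∈; neg∈; *∈; inv∈)
    open IsSubfield E-subfield using () renaming (zero∈ to zero∈E; +∈ to +∈E; *∈ to *∈E)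

    lincomb∈E : ∀ t vs → All (P K) t → All (P E) vs → P E (lincomb t vs)
    lincomb∈E (a ∷ t) (v ∷ vs) (a∈K ∷ t∈K) (v∈E ∷ vs∈E) = +∈E (*∈E (K⊆E a∈K) v∈E) (lincomb∈E t vs t∈K vs∈E)
    lincomb∈E [] vs _ _ = zero∈E
    lincomb∈E (a ∷ t) [] _ _ = zero∈E

    span⊆E : ∀ {x} vs → All (P E) vs → x ∈ span vs → P E x
    span⊆E vs vs∈E x∈span = let t , (_ , t∈K) , x≈ = ∈-span⁻ vs x∈span in resp E (sym x≈) (lincomb∈E t vs t∈K vs∈E)

    zipWith-difference∈K : ∀ {xs ys} → All (P K) xs → All (P K) ys → All (P K) (List.zipWith _-_ xs ys)
    zipWith-difference∈K (x∈K ∷ xs∈K) (y∈K ∷ ys∈K) = +∈ x∈K (neg∈ y∈K) ∷ zipWith-difference∈K xs∈K ys∈K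
    zipWith-difference∈K [] _ = []
    zipWith-difference∈K (_ ∷ _) [] = []

    -- If a ≉ a′ then (a - a′) x ≈ lincomb (t′ - t) vs exhibits x in the span.
    extend-independent : ∀ x vs → Independent vs → x ∉ span vs → Independent (x ∷ vs)
    extend-independent x vs independent x∉span {a ∷ t} {a′ ∷ t′} (|at|≡ , a∈K ∷ t∈K) (|a′t′|≡ , a′∈K ∷ t′∈K) eq
      with a ≟ a′
    ... | yes a≈a′ = a≈a′ ∷ independent (ℕ.suc-injective |at|≡ , t∈K) (ℕ.suc-injective |a′t′|≡ , t′∈K)
          (+-cancelˡ (a * x) _ _ (trans eq (+-congʳ (*-congʳ (sym a≈a′)))))
    ... | no a≉a′ = contradiction (∈.∈-resp-≈ setoid (sym x≈u) (∈-span⁺ vs (|u|≡|vs| , u∈K))) x∉span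
      where
      d : Carrier
      d = a - a′
      d≉0 : d ≉ 0#
      d≉0 d≈0 = a≉a′ (x∙y⁻¹≈ε⇒x≈y a a′ d≈0)
      d⁻¹ : Carrier
      d⁻¹ = proj₁ (inverse d d≉0)
      dd⁻¹≈1 : d * d⁻¹ ≈ 1#
      dd⁻¹≈1 = proj₂ (inverse d d≉0)
      |t′|≡|t| : length t′ ≡ length t
      |t′|≡|t| = ≡.trans (ℕ.suc-injective |a′t′|≡) (≡.sym (ℕ.suc-injective |at|≡))
      u : List Carrier
      u = List.map (d⁻¹ *_) (List.zipWith _-_ t′ t)
      |u|≡|vs| : length u ≡ length vs
      |u|≡|vs| = ≡.trans (ListP.length-map _ (List.zipWith _-_ t′ t))
        (≡.trans (ListP.length-zipWith _-_ t′ t) (≡.trans (≡.cong (ℕ._⊓ length t) |t′|≡|t|)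
          (≡.trans (ℕ.⊓-idem (length t)) (ℕ.suc-injective |at|≡))))
      u∈K : All (P K) u
      u∈K = All.map⁺ (All.map (*∈ (inv∈ (+∈ a∈K (neg∈ a′∈K)) dd⁻¹≈1))
        (zipWith-difference∈K t′∈K t∈K))
      dx≈ : d * x ≈ lincomb t′ vs - lincomb t vs
      dx≈ = begin
        (a - a′) * x                                          ≈⟨ solve 4 (λ a a′ x y → (a :- a′) :* x
                                                                  := (a :* x :+ y) :- (a′ :* x :+ y)) refl a a′ x _ ⟩
        (a * x + lincomb t vs) - (a′ * x + lincomb t vs)      ≈⟨ +-congʳ eq ⟩
        (a′ * x + lincomb t′ vs) - (a′ * x + lincomb t vs)    ≈⟨ solve 3 (λ a′x y′ y → (a′x :+ y′) :- (a′x :+ y)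
                                                                  := y′ :- y) refl (a′ * x) _ _ ⟩
        lincomb t′ vs - lincomb t vs                          ∎
      x≈u : x ≈ lincomb u vs
      x≈u = begin
        x                                      ≈⟨ *-identityˡ x ⟨
        1# * x                                 ≈⟨ *-congʳ (trans (sym dd⁻¹≈1) (*-comm d d⁻¹)) ⟩
        (d⁻¹ * d) * x                          ≈⟨ *-assoc d⁻¹ d x ⟩
        d⁻¹ * (d * x)                          ≈⟨ *-congˡ dx≈ ⟩
        d⁻¹ * (lincomb t′ vs - lincomb t vs)   ≈⟨ *-congˡ (lincomb-zipWith-difference t′ t vs |t′|≡|t|) ⟨
        d⁻¹ * lincomb (List.zipWith _-_ t′ t) vs ≈⟨ lincomb-map-*ˡ d⁻¹ (List.zipWith _-_ t′ t) vs ⟨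
        lincomb u vs                           ∎

    independent-length< : ∀ vs → All (P E) vs → Independent vs → length vs < order
    independent-length< vs vs∈E independent = ℕ.<-≤-trans (n<2^n (length vs))
      (ℕ.≤-trans (ℕ.^-monoˡ-≤ (length vs) (subfield-∣∣≥2 K K-subfield))
        (ℕ.≤-trans (ℕ.≤-reflexive (≡.sym (length-span vs)))
          (length≤∣∣ everything (span vs) (span-unique vs independent) _)))

    -- The fuel only bounds the recursion: independent lists in E are shorter than order.
    grow-basis : ∀ fuel vs → All (P E) vs → Independent vs → order ≤ fuel ℕ.+ length vs →
                 ∃ λ k → ∣ E ∣ ≡ ∣ K ∣ ℕ.^ k
    grow-basis fuel vs vs∈E independent bound with All.all? (λ x → Any.any? (x ≟_) (span vs)) (members E)
    ... | yes E⊆span = length vs , basis⇒∣∣≡ E vs independent (span⊆E vs vs∈E)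
                                     (λ x∈E → All.lookupₛ setoid (∈.∈-resp-≈ setoid) E⊆span (∈-members E x∈E))
    grow-basis zero vs vs∈E independent bound | no _ =
      contradiction bound (ℕ.<⇒≱ (independent-length< vs vs∈E independent))
    grow-basis (suc fuel) vs vs∈E independent bound | no E⊈span =
      let x , x∈ , x∉span = find (All.¬All⇒Any¬ (λ x → Any.any? (x ≟_) (span vs)) (members E) E⊈span)
      in grow-basis fuel (x ∷ vs) (All.lookup (All.tabulateₛ setoid (members-P E)) x∈ ∷ vs∈E)
           (extend-independent x vs independent x∉span)
           (ℕ.≤-trans bound (ℕ.≤-reflexive (≡.sym (ℕ.+-suc fuel (length vs)))))

    ∣E∣≡∣K∣^dim : ∃ λ k → ∣ E ∣ ≡ ∣ K ∣ ℕ.^ k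
    ∣E∣≡∣K∣^dim = grow-basis order [] [] (λ { {[]} {[]} _ _ _ → [] }) (ℕ.≤-reflexive (≡.sym (ℕ.+-identityʳ order)))

  -- Intermediate fields of an extension of prime-power degree

  everything-subfield : IsSubfield (P everything)
  everything-subfield = record
    { resp = λ _ _ → tt ; zero∈ = tt ; one∈ = tt
    ; +∈ = λ _ _ → tt ; neg∈ = λ _ → tt ; *∈ = λ _ _ → tt ; inv∈ = λ _ _ → tt }

  x^m≈x⇒x^m^t≈x : ∀ {x} m t → x ^ m ≈ x → x ^ (m ℕ.^ t) ≈ x
  x^m≈x⇒x^m^t≈x {x} m zero _ = *-identityʳ x
  x^m≈x⇒x^m^t≈x {x} m (suc t) x^m≈x = begin
    x ^ (m ℕ.* m ℕ.^ t)   ≈⟨ ^-assocʳ x m (m ℕ.^ t) ⟨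
    (x ^ m) ^ (m ℕ.^ t)   ≈⟨ ^-congˡ (m ℕ.^ t) x^m≈x ⟩
    x ^ (m ℕ.^ t)         ≈⟨ x^m≈x⇒x^m^t≈x m t x^m≈x ⟩
    x                     ∎

  fixedPoints⊆ᴰsubfield : ∀ E → IsSubfield (P E) → fixedPoints ∣ E ∣ ⊆ᴰ E
  fixedPoints⊆ᴰsubfield E E-subfield = ⊆ᴰ∧∣∣≥⇒⊇ᴰ {E} {fixedPoints ∣ E ∣} (SubfieldFermat.x^∣E∣≈x E E-subfield)
    (∣fixedPoints∣≤ ∣ E ∣ (subfield-∣∣≥2 E E-subfield))

  ∣∣≡∣∣^⇒⊆ᴰ : ∀ E₁ E₂ → IsSubfield (P E₁) → IsSubfield (P E₂) →
             ∀ t → ∣ E₂ ∣ ≡ ∣ E₁ ∣ ℕ.^ t → E₁ ⊆ᴰ E₂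
  ∣∣≡∣∣^⇒⊆ᴰ E₁ E₂ E₁-subfield E₂-subfield t ∣E₂∣≡∣E₁∣^t {x} x∈E₁ =
    fixedPoints⊆ᴰsubfield E₂ E₂-subfield
    (≡.subst (λ m → x ^ m ≈ x) (≡.sym ∣E₂∣≡∣E₁∣^t)
      (x^m≈x⇒x^m^t≈x ∣ E₁ ∣ t (SubfieldFermat.x^∣E∣≈x E₁ E₁-subfield x∈E₁)))

  module PrimePowerDegree (K : DecSubset) (K-subfield : IsSubfield (P K)) {n p k : ℕ}
                          (order≡∣K∣^n : order ≡ ∣ K ∣ ℕ.^ n) (p-prime : Prime p) (n≡p^k : n ≡ p ℕ.^ k) where

    intermediate-order : ∀ E → IsSubfield (P E) → K ⊆ᴰ E → ∃ λ i → ∣ E ∣ ≡ ∣ K ∣ ℕ.^ (p ℕ.^ i)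
    intermediate-order E E-subfield K⊆E =
      let a , ∣E∣≡∣K∣^a = Dimension.∣E∣≡∣K∣^dim K K-subfield E E-subfield K⊆E
          b , order≡∣E∣^b = Dimension.∣E∣≡∣K∣^dim E E-subfield everything everything-subfield _
          n≡ab = ^-injectiveʳ ∣ K ∣ (subfield-∣∣≥2 K K-subfield) (≡.trans (≡.sym order≡∣K∣^n)
            (≡.trans order≡∣E∣^b (≡.trans (≡.cong (ℕ._^ b) ∣E∣≡∣K∣^a) (ℕ.^-*-assoc ∣ K ∣ a b))))
          i , a≡p^i = prime-power-divisor p-prime k a b (≡.trans (≡.sym n≡ab) n≡p^k)
      in i , ≡.trans ∣E∣≡∣K∣^a (≡.cong (∣ K ∣ ℕ.^_) a≡p^i)

    intermediate-chain : ∀ E₁ E₂ → IsSubfield (P E₁) → IsSubfield (P E₂) → K ⊆ᴰ E₁ → K ⊆ᴰ E₂ →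
                         E₁ ⊆ᴰ E₂ ⊎ E₂ ⊆ᴰ E₁
    intermediate-chain E₁ E₂ E₁-subfield E₂-subfield K⊆E₁ K⊆E₂
      with intermediate-order E₁ E₁-subfield K⊆E₁ | intermediate-order E₂ E₂-subfield K⊆E₂
    ... | i , ∣E₁∣≡ | j , ∣E₂∣≡ with ℕ.≤-total i j
    ... | inj₁ i≤j = inj₁ (∣∣≡∣∣^⇒⊆ᴰ E₁ E₂ E₁-subfield E₂-subfield (p ℕ.^ (j ∸ i))
            (≡.trans ∣E₂∣≡ (≡.trans (^-^-split ∣ K ∣ p i≤j) (≡.cong (ℕ._^ (p ℕ.^ (j ∸ i))) (≡.sym ∣E₁∣≡)))))
    ... | inj₂ j≤i = inj₂ (∣∣≡∣∣^⇒⊆ᴰ E₂ E₁ E₂-subfield E₁-subfield (p ℕ.^ (i ∸ j))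
            (≡.trans ∣E₁∣≡ (≡.trans (^-^-split ∣ K ∣ p j≤i) (≡.cong (ℕ._^ (p ℕ.^ (i ∸ j))) (≡.sym ∣E₂∣≡)))))

  -- Finite sums, signs and determinants

  sumF-cong : ∀ {n} {f g : Fin n → Carrier} → (∀ i → f i ≈ g i) → sumF f ≈ sumF g
  sumF-cong {zero} _ = refl
  sumF-cong {suc n} f≈g = +-cong (f≈g Fin.zero) (sumF-cong (f≈g ∘ Fin.suc))

  sumF-+ : ∀ {n} (f g : Fin n → Carrier) → sumF (λ i → f i + g i) ≈ sumF f + sumF g
  sumF-+ {zero} f g = sym (+-identityˡ 0#)
  sumF-+ {suc n} f g = trans (+-congˡ (sumF-+ (f ∘ Fin.suc) (g ∘ Fin.suc))) (+-interchange _ _ _ _)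

  *-distribˡ-sumF : ∀ {n} a (f : Fin n → Carrier) → a * sumF f ≈ sumF (λ i → a * f i)
  *-distribˡ-sumF {zero} a f = zeroʳ a
  *-distribˡ-sumF {suc n} a f = trans (distribˡ _ _ _) (+-congˡ (*-distribˡ-sumF a (f ∘ Fin.suc)))

  sumF-≈0 : ∀ {n} (f : Fin n → Carrier) → (∀ i → f i ≈ 0#) → sumF f ≈ 0#
  sumF-≈0 {zero} f _ = refl
  sumF-≈0 {suc n} f f≈0 = trans (+-cong (f≈0 Fin.zero) (sumF-≈0 (f ∘ Fin.suc) (f≈0 ∘ Fin.suc))) (+-identityˡ 0#)

  -‿distrib-sumF : ∀ {n} (f : Fin n → Carrier) → - sumF f ≈ sumF (λ i → - f i)
  -‿distrib-sumF {zero} f = -0#≈0#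
  -‿distrib-sumF {suc n} f = trans (sym (-‿+-comm _ _)) (+-congˡ (-‿distrib-sumF (f ∘ Fin.suc)))

  sumF-comm : ∀ {n m} (g : Fin n → Fin m → Carrier) → sumF (λ i → sumF (g i)) ≈ sumF (λ j → sumF (λ i → g i j))
  sumF-comm {zero} {m} g = sym (sumF-≈0 {m} (λ _ → 0#) (λ _ → refl))
  sumF-comm {suc n} g = trans (+-congˡ (sumF-comm (g ∘ Fin.suc))) (sym (sumF-+ (g Fin.zero) _))

  sumF-δ : ∀ {n} (f : Fin n → Carrier) j → (∀ i → i ≢ j → f i ≈ 0#) → sumF f ≈ f j
  sumF-δ {suc n} f Fin.zero f≈0 = trans (+-congˡ (sumF-≈0 _ (λ i → f≈0 (Fin.suc i) λ ()))) (+-identityʳ _)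
  sumF-δ {suc n} f (Fin.suc j) f≈0 = trans (+-cong (f≈0 Fin.zero λ ())
    (sumF-δ (f ∘ Fin.suc) j (λ i i≢j → f≈0 (Fin.suc i) (i≢j ∘ Fin.suc-injective)))) (+-identityˡ _)

  -- The pairs (inject₁ j, k) and (suc k, j) with j ≤ k enumerate Fin (suc m) × Fin m.
  sumF-sumF-pairs≈0 : ∀ m (f : Fin (suc m) → Fin m → Carrier) →
                      (∀ (j k : Fin m) → toℕ j ≤ toℕ k → f (inject₁ j) k + f (Fin.suc k) j ≈ 0#) →
                      sumF (λ j → sumF (f j)) ≈ 0#
  sumF-sumF-pairs≈0 zero f _ = +-identityˡ 0#
  sumF-sumF-pairs≈0 (suc m) f pairs≈0 = begin
    sumF (f Fin.zero) + sumF (λ j → f (Fin.suc j) Fin.zero + sumF (λ k → f (Fin.suc j) (Fin.suc k)))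
      ≈⟨ +-congˡ (sumF-+ (λ j → f (Fin.suc j) Fin.zero) (λ j → sumF (λ k → f (Fin.suc j) (Fin.suc k)))) ⟩
    sumF (f Fin.zero) + (sumF (λ j → f (Fin.suc j) Fin.zero) + sumF (λ j → sumF (λ k → f (Fin.suc j) (Fin.suc k))))
      ≈⟨ +-congˡ (+-congˡ (sumF-sumF-pairs≈0 m (λ j k → f (Fin.suc j) (Fin.suc k))
                                               (λ j k j≤k → pairs≈0 (Fin.suc j) (Fin.suc k) (s≤s j≤k)))) ⟩
    sumF (f Fin.zero) + (sumF (λ j → f (Fin.suc j) Fin.zero) + 0#)
      ≈⟨ +-congˡ (+-identityʳ _) ⟩
    sumF (f Fin.zero) + sumF (λ j → f (Fin.suc j) Fin.zero)
      ≈⟨ sumF-+ (f Fin.zero) (λ k → f (Fin.suc k) Fin.zero) ⟨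
    sumF (λ k → f Fin.zero k + f (Fin.suc k) Fin.zero)
      ≈⟨ sumF-≈0 _ (λ k → pairs≈0 Fin.zero k z≤n) ⟩
    0# ∎

  sign-cong : ∀ k {x y} → x ≈ y → sign k x ≈ sign k y
  sign-cong zero x≈y = x≈y
  sign-cong (suc k) x≈y = -‿cong (sign-cong k x≈y)

  sign-≈-* : ∀ k x → sign k x ≈ sign k 1# * x
  sign-≈-* zero x = sym (*-identityˡ x)
  sign-≈-* (suc k) x = trans (-‿cong (sign-≈-* k x)) (-‿distribˡ-* _ _)

  sign-+ : ∀ k x y → sign k (x + y) ≈ sign k x + sign k y
  sign-+ k x y = trans (sign-≈-* k _) (trans (distribˡ _ _ _) (sym (+-cong (sign-≈-* k x) (sign-≈-* k y))))

  sign-* : ∀ k a x → sign k (a * x) ≈ a * sign k x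
  sign-* k a x = trans (sign-≈-* k _) (trans (x∙yz≈y∙xz _ a x) (*-congˡ (sym (sign-≈-* k x))))

  sign-sumF : ∀ k {n} (f : Fin n → Carrier) → sign k (sumF f) ≈ sumF (λ i → sign k (f i))
  sign-sumF k f = trans (sign-≈-* k _) (trans (*-distribˡ-sumF _ f) (sumF-cong (λ i → sym (sign-≈-* k (f i)))))

  sign-≈0 : ∀ k {x} → x ≈ 0# → sign k x ≈ 0#
  sign-≈0 k x≈0 = trans (sign-cong k x≈0) (trans (sign-≈-* k 0#) (zeroʳ _))

  sign-involutive : ∀ k x → sign k (sign k x) ≈ x
  sign-involutive zero x = refl
  sign-involutive (suc k) x = trans (-‿cong (sign-neg k (sign k x))) (trans (-‿involutive _) (sign-involutive k x))
    where
    sign-neg : ∀ k y → sign k (- y) ≈ - sign k y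
    sign-neg zero y = refl
    sign-neg (suc k) y = -‿cong (sign-neg k y)

  sign-closed : ∀ {S} → IsSubfield S → ∀ k {x} → S x → S (sign k x)
  sign-closed S-subfield zero x∈S = x∈S
  sign-closed S-subfield (suc k) x∈S = IsSubfield.neg∈ S-subfield (sign-closed S-subfield k x∈S)

  Matrix : ℕ → Set c
  Matrix n = Fin n → Fin n → Carrier

  minor : ∀ {n} → Matrix (suc n) → Fin (suc n) → Matrix n
  minor M j i k = M (Fin.suc i) (punchIn j k)

  Det : ∀ n → Matrix n → Carrier
  Det zero M = 1#
  Det (suc n) M = sumF (λ j → sign (toℕ j) (M Fin.zero j * Det n (minor M j)))

  Det-cong : ∀ n {M M′ : Matrix n} → (∀ i j → M i j ≈ M′ i j) → Det n M ≈ Det n M′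
  Det-cong zero _ = refl
  Det-cong (suc n) M≈M′ = sumF-cong (λ j → sign-cong (toℕ j)
    (*-cong (M≈M′ Fin.zero j) (Det-cong n (λ i k → M≈M′ (Fin.suc i) (punchIn j k)))))

  Det-cong-rows : ∀ n {M M′ : Matrix n} → (∀ i → M i ≡ M′ i) → Det n M ≈ Det n M′
  Det-cong-rows n M≡M′ = Det-cong n (λ i j → reflexive (≡.cong (_$ j) (M≡M′ i)))

  _[_]≔_ : ∀ {n} → Matrix n → Fin n → (Fin n → Carrier) → Matrix n
  M [ r ]≔ v = updateAt M r (const v)

  minor-[]≔ : ∀ {n} (M : Matrix (suc (suc n))) r v j i →
              minor (M [ Fin.suc r ]≔ v) j i ≡ (minor M j [ r ]≔ (v ∘ punchIn j)) i
  minor-[]≔ M r v j i = map-updateAt-local {f = _∘ punchIn j} (M ∘ Fin.suc) r ≡.refl i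

  RowsEqual : ∀ {n} → Matrix n → Fin n → Fin n → Set ℓ
  RowsEqual M a b = ∀ j → M a j ≈ M b j

  Det-linear : ∀ n (M : Matrix n) r x y →
               Det n (M [ r ]≔ (λ k → x k + y k)) ≈ Det n (M [ r ]≔ x) + Det n (M [ r ]≔ y)
  Det-linear (suc n) M Fin.zero x y = trans (sumF-cong (λ j → trans
    (sign-cong (toℕ j) (distribʳ (Det n (minor M j)) (x j) (y j))) (sign-+ (toℕ j) _ _)))
    (sumF-+ (λ j → sign (toℕ j) (x j * Det n (minor M j))) (λ j → sign (toℕ j) (y j * Det n (minor M j))))
  Det-linear (suc (suc n)) M (Fin.suc r) x y = trans (sumF-cong expand-row0)
    (sumF-+ (λ j → sign (toℕ j) (M Fin.zero j * Dminor x j)) (λ j → sign (toℕ j) (M Fin.zero j * Dminor y j)))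
    where
    Dminor : (Fin (suc (suc n)) → Carrier) → Fin (suc (suc n)) → Carrier
    Dminor v j = Det (suc n) (minor (M [ Fin.suc r ]≔ v) j)
    Dminor-linear : ∀ j → Dminor (λ k → x k + y k) j ≈ Dminor x j + Dminor y j
    Dminor-linear j = trans (Det-cong-rows (suc n) (minor-[]≔ M r _ j))
      (trans (Det-linear (suc n) (minor M j) r (x ∘ punchIn j) (y ∘ punchIn j))
        (sym (+-cong (Det-cong-rows (suc n) (minor-[]≔ M r x j)) (Det-cong-rows (suc n) (minor-[]≔ M r y j)))))
    expand-row0 : ∀ j → sign (toℕ j) (M Fin.zero j * Dminor (λ k → x k + y k) j) ≈
                        sign (toℕ j) (M Fin.zero j * Dminor x j) + sign (toℕ j) (M Fin.zero j * Dminor y j)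
    expand-row0 j = trans (sign-cong (toℕ j) (trans (*-congˡ (Dminor-linear j)) (distribˡ _ _ _))) (sign-+ (toℕ j) _ _)

  -- Expanding along row 0 and then row 1, the terms for columns (j, k) and (k, j) cancel.
  Det-rows01-equal : ∀ m (M : Matrix (suc (suc m))) → RowsEqual M Fin.zero (Fin.suc Fin.zero) →
                     Det (suc (suc m)) M ≈ 0#
  Det-rows01-equal m M rows≈ = trans (sumF-cong (λ j → trans (sign-cong (toℕ j) (*-distribˡ-sumF (M Fin.zero j) (g j)))
    (sign-sumF (toℕ j) (λ k → M Fin.zero j * g j k)))) (sumF-sumF-pairs≈0 (suc m) f pairs≈0)
    where
    g : Fin (suc (suc m)) → Fin (suc m) → Carrier
    g j k = sign (toℕ k) (M (Fin.suc Fin.zero) (punchIn j k) * Det m (minor (minor M j) k))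
    f : Fin (suc (suc m)) → Fin (suc m) → Carrier
    f j k = sign (toℕ j) (M Fin.zero j * g j k)
    pairs≈0 : ∀ (j k : Fin (suc m)) → toℕ j ≤ toℕ k → f (inject₁ j) k + f (Fin.suc k) j ≈ 0#
    pairs≈0 j k j≤k = begin
      f (inject₁ j) k + f (Fin.suc k) j
        ≈⟨ +-cong (trans (sign-≈-* (toℕ (inject₁ j)) _) (*-cong (reflexive (≡.cong (λ i → sign i 1#) (Fin.toℕ-inject₁ j)))
                     (*-congˡ (trans (sign-≈-* (toℕ k) _) (*-congˡ (*-cong row1≈b minor≈X))))))
                  (-‿cong (trans (sign-≈-* (toℕ k) _)
                    (*-congˡ (*-congˡ (trans (sign-≈-* (toℕ j) _) (*-congˡ (*-congʳ row1≈a))))))) ⟩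
      sⱼ * (a * (sₖ * (b * X))) - sₖ * (b * (sⱼ * (a * X)))
        ≈⟨ solve 5 (λ sⱼ sₖ a b x → sⱼ :* (a :* (sₖ :* (b :* x))) :- sₖ :* (b :* (sⱼ :* (a :* x))) := con (ℤ.+ 0))
             refl _ _ a b X ⟩
      0# ∎
      where
      sⱼ sₖ a b X : Carrier
      sⱼ = sign (toℕ j) 1#
      sₖ = sign (toℕ k) 1#
      a = M Fin.zero (inject₁ j)
      b = M Fin.zero (Fin.suc k)
      X = Det m (minor (minor M (Fin.suc k)) j)
      row1≈b : M (Fin.suc Fin.zero) (punchIn (inject₁ j) k) ≈ b
      row1≈b = trans (reflexive (≡.cong (M (Fin.suc Fin.zero)) (punchIn-inject₁ j k j≤k))) (sym (rows≈ (Fin.suc k)))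
      row1≈a : M (Fin.suc Fin.zero) (punchIn (Fin.suc k) j) ≈ a
      row1≈a = trans (reflexive (≡.cong (M (Fin.suc Fin.zero)) (punchIn-suc j k j≤k))) (sym (rows≈ (inject₁ j)))
      minor≈X : Det m (minor (minor M (inject₁ j)) k) ≈ X
      minor≈X = Det-cong m (λ i l → reflexive (≡.cong (M (Fin.suc (Fin.suc i))) (punchIn-punchIn j k j≤k l)))

  mutual
    Det-equal-rows : ∀ n (M : Matrix n) a b → a ≢ b → RowsEqual M a b → Det n M ≈ 0#
    Det-equal-rows (suc n) M Fin.zero Fin.zero 0≢0 _ = contradiction ≡.refl 0≢0
    Det-equal-rows (suc n) M (Fin.suc a) (Fin.suc b) a≢b rows≈ = Det-equal-lower-rows n M a b (a≢b ∘ ≡.cong Fin.suc) rows≈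
    Det-equal-rows (suc n) M Fin.zero (Fin.suc b) _ rows≈ = Det-equal-row0 n M b rows≈
    Det-equal-rows (suc n) M (Fin.suc a) Fin.zero _ rows≈ = Det-equal-row0 n M a (sym ∘ rows≈)

    Det-equal-lower-rows : ∀ n (M : Matrix (suc n)) a b → a ≢ b → RowsEqual M (Fin.suc a) (Fin.suc b) →
                           Det (suc n) M ≈ 0#
    Det-equal-lower-rows n M a b a≢b rows≈ = sumF-≈0 _ (λ j → sign-≈0 (toℕ j)
      (trans (*-congˡ (Det-equal-rows n (minor M j) a b a≢b (rows≈ ∘ punchIn j))) (zeroʳ (M Fin.zero j))))

    -- Swapping rows 1 and b + 1 reduces to Det-rows01-equal.
    Det-equal-row0 : ∀ n (M : Matrix (suc n)) (b : Fin n) → RowsEqual M Fin.zero (Fin.suc b) → Det (suc n) M ≈ 0#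
    Det-equal-row0 (suc m) M Fin.zero rows≈ = Det-rows01-equal m M rows≈
    Det-equal-row0 (suc m) M (Fin.suc b) rows≈ = begin
      Det (suc (suc m)) M    ≈⟨ +-inverseʳ-unique (Det (suc (suc m)) M′) _
                                  (trans (+-comm _ _) (Det-swap-lower-rows (suc m) M Fin.zero (Fin.suc b) λ ())) ⟩
      - Det (suc (suc m)) M′ ≈⟨ -‿cong (Det-rows01-equal m M′ rows≈) ⟩
      - 0#                   ≈⟨ -0#≈0# ⟩
      0#                     ∎
      where
      M′ : Matrix (suc (suc m))
      M′ = (M [ Fin.suc Fin.zero ]≔ M (Fin.suc (Fin.suc b))) [ Fin.suc (Fin.suc b) ]≔ M (Fin.suc Fin.zero)

    -- Expand the matrix with x + y in both swapped rows by linearity in each.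
    Det-swap-lower-rows : ∀ n (M : Matrix (suc n)) r s → r ≢ s →
                          Det (suc n) M + Det (suc n) ((M [ Fin.suc r ]≔ M (Fin.suc s)) [ Fin.suc s ]≔ M (Fin.suc r)) ≈ 0#
    Det-swap-lower-rows n M r s r≢s = begin
      Det (suc n) M + Q y x               ≈⟨ +-congʳ Qxy≈M ⟨
      Q x y + Q y x                       ≈⟨ +-cong (trans (+-congʳ (Q-diagonal x)) (+-identityˡ _))
                                                    (trans (+-congˡ (Q-diagonal y)) (+-identityʳ _)) ⟨
      (Q x x + Q x y) + (Q y x + Q y y)   ≈⟨ +-cong (Det-linear (suc n) (M [ r′ ]≔ x) s′ x y)
                                                    (Det-linear (suc n) (M [ r′ ]≔ y) s′ x y) ⟨
      Q x (x ⊕ y) + Q y (x ⊕ y)           ≈⟨ Q-linearˡ (x ⊕ y) ⟨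
      Q (x ⊕ y) (x ⊕ y)                   ≈⟨ Q-diagonal (x ⊕ y) ⟩
      0#                                  ∎
      where
      r′ s′ : Fin (suc n)
      r′ = Fin.suc r
      s′ = Fin.suc s
      r′≢s′ : r′ ≢ s′
      r′≢s′ = r≢s ∘ Fin.suc-injective
      x y : Fin (suc n) → Carrier
      x = M r′
      y = M s′
      _⊕_ : (Fin (suc n) → Carrier) → (Fin (suc n) → Carrier) → Fin (suc n) → Carrier
      (u ⊕ v) k = u k + v k
      Q : (Fin (suc n) → Carrier) → (Fin (suc n) → Carrier) → Carrier
      Q u v = Det (suc n) ((M [ r′ ]≔ u) [ s′ ]≔ v)
      Qxy≈M : Q x y ≈ Det (suc n) M
      Qxy≈M = Det-cong-rows (suc n) (λ i →
        ≡.trans (≡.cong (λ w → ((M [ r′ ]≔ x) [ s′ ]≔ w) i) (≡.sym (updateAt-minimal s′ r′ M (r′≢s′ ∘ ≡.sym))))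
          (≡.trans (updateAt-id-local s′ (M [ r′ ]≔ x) ≡.refl i) (updateAt-id-local r′ M ≡.refl i)))
      Q-diagonal : ∀ z → Q z z ≈ 0#
      Q-diagonal z = Det-equal-lower-rows n ((M [ r′ ]≔ z) [ s′ ]≔ z) r s r≢s (λ j → reflexive (≡.cong (_$ j)
        (≡.trans (updateAt-minimal r′ s′ (M [ r′ ]≔ z) r′≢s′)
          (≡.trans (updateAt-updates r′ M) (≡.sym (updateAt-updates s′ (M [ r′ ]≔ z)))))))
      commute : ∀ u v → ∀ i → ((M [ r′ ]≔ u) [ s′ ]≔ v) i ≡ ((M [ s′ ]≔ v) [ r′ ]≔ u) i
      commute u v = updateAt-commutes s′ r′ (r′≢s′ ∘ ≡.sym) M
      Q-linearˡ : ∀ v → Q (x ⊕ y) v ≈ Q x v + Q y v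
      Q-linearˡ v = trans (Det-cong-rows (suc n) (commute (x ⊕ y) v))
        (trans (Det-linear (suc n) (M [ s′ ]≔ v) r′ x y)
          (sym (+-cong (Det-cong-rows (suc n) (commute x v)) (Det-cong-rows (suc n) (commute y v)))))

  -- b ≠ 0 is a left null vector of N: subtracting Σ b(i+1) row(i+1) from b 0 · row 0 leaves only determinants
  -- of matrices with two equal rows.
  Det-singular : ∀ n (N : Matrix (suc n)) (b : Fin (suc n) → Carrier) → b Fin.zero ≉ 0# →
                 (∀ j → sumF (λ i → b i * N i j) ≈ 0#) → Det (suc n) N ≈ 0#
  Det-singular n N b b₀≉0 bN≈0 = x*y≈0⇒y≈0 b₀≉0 (begin
    b Fin.zero * Det (suc n) N
      ≈⟨ *-distribˡ-sumF (b Fin.zero) (λ j → sign (toℕ j) (N Fin.zero j * C j)) ⟩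
    sumF (λ j → b Fin.zero * sign (toℕ j) (N Fin.zero j * C j))   ≈⟨ sumF-cong column-term ⟩
    sumF (λ j → - sumF (λ i → u i j))                             ≈⟨ -‿distrib-sumF (λ j → sumF (λ i → u i j)) ⟨
    - sumF (λ j → sumF (λ i → u i j))                             ≈⟨ -‿cong (sumF-comm u) ⟨
    - sumF (λ i → sumF (u i))                                     ≈⟨ -‿cong (sumF-≈0 (λ i → sumF (u i)) row-term) ⟩
    - 0#                                                          ≈⟨ -0#≈0# ⟩
    0#                                                            ∎)
    where
    C : Fin (suc n) → Carrier
    C j = Det n (minor N j)
    u : Fin n → Fin (suc n) → Carrier
    u i j = sign (toℕ j) (b (Fin.suc i) * (N (Fin.suc i) j * C j))
    column-term : ∀ j → b Fin.zero * sign (toℕ j) (N Fin.zero j * C j) ≈ - sumF (λ i → u i j)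
    column-term j = begin
      b Fin.zero * sign (toℕ j) (N Fin.zero j * C j)              ≈⟨ trans (sign-cong (toℕ j) (*-assoc _ _ _)) (sign-* (toℕ j) _ _) ⟨
      sign (toℕ j) ((b Fin.zero * N Fin.zero j) * C j)            ≈⟨ sign-cong (toℕ j) (*-congʳ b₀N₀ⱼ≈) ⟩
      sign (toℕ j) (- sumF (λ i → b (Fin.suc i) * N (Fin.suc i) j) * C j)
        ≈⟨ sign-cong (toℕ j) (trans (sym (-‿distribˡ-* _ _)) (-‿cong (trans (*-comm _ _)
             (*-distribˡ-sumF (C j) (λ i → b (Fin.suc i) * N (Fin.suc i) j))))) ⟩
      sign (toℕ j) (- sumF (λ i → C j * (b (Fin.suc i) * N (Fin.suc i) j)))
        ≈⟨ trans (sign-≈-* (toℕ j) _) (trans (sym (-‿distribʳ-* _ _)) (-‿cong (sym (sign-≈-* (toℕ j) _)))) ⟩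
      - sign (toℕ j) (sumF (λ i → C j * (b (Fin.suc i) * N (Fin.suc i) j)))
        ≈⟨ -‿cong (trans (sign-sumF (toℕ j) (λ i → C j * (b (Fin.suc i) * N (Fin.suc i) j))) (sumF-cong (λ i → sign-cong (toℕ j)
             (solve 3 (λ c b n → c :* (b :* n) := b :* (n :* c)) refl (C j) (b (Fin.suc i)) (N (Fin.suc i) j))))) ⟩
      - sumF (λ i → u i j)                                        ∎
      where
      b₀N₀ⱼ≈ : b Fin.zero * N Fin.zero j ≈ - sumF (λ i → b (Fin.suc i) * N (Fin.suc i) j)
      b₀N₀ⱼ≈ = +-inverseʳ-unique _ _ (trans (+-comm _ _) (bN≈0 j))
    row-term : ∀ i → sumF (u i) ≈ 0#
    row-term i = begin
      sumF (u i)
        ≈⟨ sumF-cong (λ j → sign-* (toℕ j) (b (Fin.suc i)) (N (Fin.suc i) j * C j)) ⟩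
      sumF (λ j → b (Fin.suc i) * sign (toℕ j) (N (Fin.suc i) j * C j))
        ≈⟨ *-distribˡ-sumF (b (Fin.suc i)) (λ j → sign (toℕ j) (N (Fin.suc i) j * C j)) ⟨
      b (Fin.suc i) * Det (suc n) (N [ Fin.zero ]≔ N (Fin.suc i))
        ≈⟨ *-congˡ (Det-equal-rows (suc n) (N [ Fin.zero ]≔ N (Fin.suc i)) Fin.zero (Fin.suc i) (λ ()) (λ _ → refl)) ⟩
      b (Fin.suc i) * 0#                                          ≈⟨ zeroʳ _ ⟩
      0#                                                          ∎

  -- Polynomials and the characteristic polynomial

  evalP : Poly → Carrier → Carrier
  evalP [] x = 0#
  evalP (a ∷ p) x = a + x * evalP p x

  evalP-+P : ∀ p q x → evalP (p +P q) x ≈ evalP p x + evalP q x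
  evalP-+P [] q x = sym (+-identityˡ _)
  evalP-+P (a ∷ p) [] x = sym (+-identityʳ _)
  evalP-+P (a ∷ p) (b ∷ q) x = trans (+-congˡ (*-congˡ (evalP-+P p q x)))
    (solve 5 (λ a b x u v → (a :+ b) :+ x :* (u :+ v) := (a :+ x :* u) :+ (b :+ x :* v)) refl a b x _ _)

  evalP-scaleP : ∀ a p x → evalP (scaleP a p) x ≈ a * evalP p x
  evalP-scaleP a [] x = sym (zeroʳ a)
  evalP-scaleP a (b ∷ p) x = trans (+-congˡ (*-congˡ (evalP-scaleP a p x)))
    (solve 4 (λ a b x u → a :* b :+ x :* (a :* u) := a :* (b :+ x :* u)) refl a b x _)

  evalP-*P : ∀ p q x → evalP (p *P q) x ≈ evalP p x * evalP q x
  evalP-*P [] q x = sym (zeroˡ _)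
  evalP-*P (a ∷ p) q x = begin
    evalP (scaleP a q +P (0# ∷ (p *P q))) x           ≈⟨ evalP-+P (scaleP a q) (0# ∷ (p *P q)) x ⟩
    evalP (scaleP a q) x + (0# + x * evalP (p *P q) x)
      ≈⟨ +-cong (evalP-scaleP a q x) (trans (+-identityˡ _) (*-congˡ (evalP-*P p q x))) ⟩
    a * evalP q x + x * (evalP p x * evalP q x)
      ≈⟨ solve 4 (λ a q x p → a :* q :+ x :* (p :* q) := (a :+ x :* p) :* q) refl a _ x _ ⟩
    (a + x * evalP p x) * evalP q x                   ∎

  evalP-negP : ∀ p x → evalP (negP p) x ≈ - evalP p x
  evalP-negP p x = trans (evalP-scaleP (- 1#) p x) (-1*x≈-x _)

  evalP-signP : ∀ k p x → evalP (signP k p) x ≈ sign k (evalP p x)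
  evalP-signP zero p x = refl
  evalP-signP (suc k) p x = trans (evalP-negP (signP k p) x) (-‿cong (evalP-signP k p x))

  evalP-sumP : ∀ {n} (f : Fin n → Poly) x → evalP (sumP f) x ≈ sumF (λ i → evalP (f i) x)
  evalP-sumP {zero} f x = refl
  evalP-sumP {suc n} f x = trans (evalP-+P (f Fin.zero) (sumP (f ∘ Fin.suc)) x) (+-congˡ (evalP-sumP (f ∘ Fin.suc) x))

  evalP-det : ∀ n (m : Fin n → Fin n → Poly) x → evalP (det n m) x ≈ Det n (λ i j → evalP (m i j) x)
  evalP-det zero m x = trans (+-congˡ (zeroʳ x)) (+-identityʳ _)
  evalP-det (suc n) m x = trans (evalP-sumP (λ j → signP (toℕ j) (m Fin.zero j *P det n (minorP j))) x)
    (sumF-cong (λ j → trans (evalP-signP (toℕ j) (m Fin.zero j *P det n (minorP j)) x) (sign-cong (toℕ j)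
      (trans (evalP-*P (m Fin.zero j) (det n (minorP j)) x) (*-congˡ (evalP-det n (minorP j) x))))))
    where
    minorP : Fin (suc n) → Fin n → Fin n → Poly
    minorP j i k = m (Fin.suc i) (punchIn j k)

  coeff-+P : ∀ j p q → coeff j (p +P q) ≈ coeff j p + coeff j q
  coeff-+P j [] q = sym (+-identityˡ _)
  coeff-+P j (a ∷ p) [] = sym (+-identityʳ _)
  coeff-+P zero (a ∷ p) (b ∷ q) = refl
  coeff-+P (suc j) (a ∷ p) (b ∷ q) = coeff-+P j p q

  coeff-scaleP : ∀ j a p → coeff j (scaleP a p) ≈ a * coeff j p
  coeff-scaleP j a [] = sym (zeroʳ a)
  coeff-scaleP zero a (b ∷ p) = refl
  coeff-scaleP (suc j) a (b ∷ p) = coeff-scaleP j a p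

  coeff-signP : ∀ j k p → coeff j (signP k p) ≈ sign k (coeff j p)
  coeff-signP j zero p = refl
  coeff-signP j (suc k) p = trans (trans (coeff-scaleP j (- 1#) (signP k p)) (-1*x≈-x _)) (-‿cong (coeff-signP j k p))

  coeff-sumP : ∀ j {n} (f : Fin n → Poly) → coeff j (sumP f) ≈ sumF (λ i → coeff j (f i))
  coeff-sumP j {zero} f = refl
  coeff-sumP j {suc n} f = trans (coeff-+P j (f Fin.zero) (sumP (f ∘ Fin.suc))) (+-congˡ (coeff-sumP j (f ∘ Fin.suc)))

  coeff-*P-∷ : ∀ j a p q → coeff j ((a ∷ p) *P q) ≈ a * coeff j q + coeff j (0# ∷ (p *P q))
  coeff-*P-∷ j a p q = trans (coeff-+P j (scaleP a q) (0# ∷ (p *P q))) (+-congʳ (coeff-scaleP j a q))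

  Deg< : Poly → ℕ → Set ℓ
  Deg< p d = ∀ j → d ≤ j → coeff j p ≈ 0#

  Deg<-mono : ∀ {p a b} → a ≤ b → Deg< p a → Deg< p b
  Deg<-mono a≤b p<a j b≤j = p<a j (ℕ.≤-trans a≤b b≤j)

  *P-zeroˡ : ∀ p q → Deg< p 0 → Deg< (p *P q) 0
  *P-zeroˡ [] q _ j _ = refl
  *P-zeroˡ (a ∷ p) q p≈0 zero _ = trans (coeff-*P-∷ zero a p q)
    (trans (+-congʳ (trans (*-congʳ (p≈0 zero z≤n)) (zeroˡ _))) (+-identityˡ _))
  *P-zeroˡ (a ∷ p) q p≈0 (suc j) _ = trans (coeff-*P-∷ (suc j) a p q)
    (trans (+-cong (trans (*-congʳ (p≈0 zero z≤n)) (zeroˡ _)) (*P-zeroˡ p q (λ j _ → p≈0 (suc j) z≤n) j z≤n)) (+-identityˡ _))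

  *P-Deg< : ∀ p q a b → Deg< p a → Deg< q (suc b) → Deg< (p *P q) (a ℕ.+ b)
  *P-Deg< [] q a b _ _ j _ = refl
  *P-Deg< (c ∷ p) q zero b p<0 _ = Deg<-mono {(c ∷ p) *P q} z≤n (*P-zeroˡ (c ∷ p) q p<0)
  *P-Deg< (c ∷ p) q (suc a) b p< q< (suc j) (s≤s a+b≤j) = trans (coeff-*P-∷ (suc j) c p q)
    (trans (+-cong (trans (*-congˡ (q< (suc j) (s≤s (ℕ.≤-trans (ℕ.m≤n+m b a) a+b≤j)))) (zeroʳ c))
                   (*P-Deg< p q a b (λ j a≤j → p< (suc j) (s≤s a≤j)) q< j a+b≤j)) (+-identityˡ _))

  coeff-*P-top : ∀ p q a b → Deg< p (suc a) → Deg< q (suc b) → coeff (a ℕ.+ b) (p *P q) ≈ coeff a p * coeff b q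
  coeff-*P-top [] q a b _ _ = sym (zeroˡ _)
  coeff-*P-top (c ∷ p) q zero b p<1 _ = trans (coeff-*P-∷ b c p q) (trans (+-congˡ (tail≈0 b)) (+-identityʳ _))
    where
    tail≈0 : ∀ b → coeff b (0# ∷ (p *P q)) ≈ 0#
    tail≈0 zero = refl
    tail≈0 (suc b) = *P-zeroˡ p q (λ j _ → p<1 (suc j) (s≤s z≤n)) b z≤n
  coeff-*P-top (c ∷ p) q (suc a) b p< q< = trans (coeff-*P-∷ (suc (a ℕ.+ b)) c p q)
    (trans (+-cong (trans (*-congˡ (q< (suc (a ℕ.+ b)) (s≤s (ℕ.m≤n+m b a)))) (zeroʳ c))
                   (coeff-*P-top p q a b (λ j a≤j → p< (suc j) (s≤s a≤j)) q<)) (+-identityˡ _))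

  det-Deg< : ∀ n (m : Fin n → Fin n → Poly) → (∀ i j → Deg< (m i j) 2) → Deg< (det n m) (suc n)
  det-Deg< zero m _ (suc j) _ = refl
  det-Deg< (suc n) m m<2 j n<j = trans (coeff-sumP j (λ k → signP (toℕ k) (m Fin.zero k *P det n (minorP k))))
    (sumF-≈0 _ (λ k → trans (coeff-signP j (toℕ k) (m Fin.zero k *P det n (minorP k))) (sign-≈0 (toℕ k)
      (*P-Deg< (m Fin.zero k) (det n (minorP k)) 2 n (m<2 Fin.zero k)
        (det-Deg< n (minorP k) (λ i l → m<2 (Fin.suc i) (punchIn k l))) j n<j))))
    where
    minorP : Fin (suc n) → Fin n → Fin n → Poly
    minorP j i k = m (Fin.suc i) (punchIn j k)

  -- The shape of the entries of X·I − A.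
  CharShaped : ∀ {n} → (Fin n → Fin n → Poly) → Set ℓ
  CharShaped m = ∀ i j → Deg< (m i j) 2 × (i ≡ j → coeff 1 (m i j) ≈ 1#) × (i ≢ j → Deg< (m i j) 1)

  det-monic : ∀ n (m : Fin n → Fin n → Poly) → CharShaped m → coeff n (det n m) ≈ 1#
  det-monic zero m _ = refl
  det-monic (suc n) m shaped = trans (coeff-sumP (suc n) (λ k → signP (toℕ k) (m Fin.zero k *P det n (minorP k))))
    (trans (+-cong diagonal-term (sumF-≈0 _ off-diagonal-term)) (+-identityʳ _))
    where
    minorP : Fin (suc n) → Fin n → Fin n → Poly
    minorP k i l = m (Fin.suc i) (punchIn k l)
    diagonal-term : coeff (suc n) (m Fin.zero Fin.zero *P det n (minorP Fin.zero)) ≈ 1#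
    diagonal-term = trans (coeff-*P-top (m Fin.zero Fin.zero) (det n (minorP Fin.zero)) 1 n
        (proj₁ (shaped Fin.zero Fin.zero)) (det-Deg< n (minorP Fin.zero) (λ i l → proj₁ (shaped (Fin.suc i) (Fin.suc l)))))
      (trans (*-cong (proj₁ (proj₂ (shaped Fin.zero Fin.zero)) ≡.refl)
        (det-monic n (minorP Fin.zero) (λ i l → let deg , diag , off = shaped (Fin.suc i) (Fin.suc l)
                                                 in deg , diag ∘ ≡.cong Fin.suc , λ i≢l → off (i≢l ∘ Fin.suc-injective))))
        (*-identityˡ _))
    off-diagonal-term : ∀ k → coeff (suc n) (signP (toℕ (Fin.suc k)) (m Fin.zero (Fin.suc k) *P det n (minorP (Fin.suc k)))) ≈ 0#
    off-diagonal-term k = trans (coeff-signP (suc n) (toℕ (Fin.suc k)) _) (sign-≈0 (toℕ (Fin.suc k))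
      (*P-Deg< (m Fin.zero (Fin.suc k)) (det n (minorP (Fin.suc k))) 1 n (proj₂ (proj₂ (shaped Fin.zero (Fin.suc k))) λ ())
        (det-Deg< n (minorP (Fin.suc k)) (λ i l → proj₁ (shaped (Fin.suc i) (punchIn (Fin.suc k) l)))) (suc n) ℕ.≤-refl))

  module PolyClosure {S : Pred Carrier ℓ} (S-subfield : IsSubfield S) where
    open IsSubfield S-subfield

    +P-closed : ∀ {p q} → All S p → All S q → All S (p +P q)
    +P-closed [] q∈S = q∈S
    +P-closed (a∈S ∷ p∈S) [] = a∈S ∷ p∈S
    +P-closed (a∈S ∷ p∈S) (b∈S ∷ q∈S) = +∈ a∈S b∈S ∷ +P-closed p∈S q∈S

    scaleP-closed : ∀ {a p} → S a → All S p → All S (scaleP a p)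
    scaleP-closed a∈S [] = []
    scaleP-closed a∈S (b∈S ∷ p∈S) = *∈ a∈S b∈S ∷ scaleP-closed a∈S p∈S

    *P-closed : ∀ {p q} → All S p → All S q → All S (p *P q)
    *P-closed [] q∈S = []
    *P-closed (a∈S ∷ p∈S) q∈S = +P-closed (scaleP-closed a∈S q∈S) (zero∈ ∷ *P-closed p∈S q∈S)

    negP-closed : ∀ {p} → All S p → All S (negP p)
    negP-closed = scaleP-closed (neg∈ one∈)

    signP-closed : ∀ k {p} → All S p → All S (signP k p)
    signP-closed zero p∈S = p∈S
    signP-closed (suc k) p∈S = negP-closed (signP-closed k p∈S)

    sumP-closed : ∀ {n} (f : Fin n → Poly) → (∀ i → All S (f i)) → All S (sumP f)
    sumP-closed {zero} f _ = []
    sumP-closed {suc n} f f∈S = +P-closed (f∈S Fin.zero) (sumP-closed (f ∘ Fin.suc) (f∈S ∘ Fin.suc))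

    det-closed : ∀ n (m : Fin n → Fin n → Poly) → (∀ i j → All S (m i j)) → All S (det n m)
    det-closed zero m _ = one∈ ∷ []
    det-closed (suc n) m m∈S = sumP-closed _ (λ j → signP-closed (toℕ j)
      (*P-closed (m∈S Fin.zero j) (det-closed n _ (λ i k → m∈S (Fin.suc i) (punchIn j k)))))

    coeff-closed : ∀ j {p} → All S p → S (coeff j p)
    coeff-closed j [] = zero∈
    coeff-closed zero (a∈S ∷ _) = a∈S
    coeff-closed (suc j) (_ ∷ p∈S) = coeff-closed j p∈S

    evalP-closed : ∀ {β} → S β → ∀ {u} → All S u → S (evalP u β)
    evalP-closed β∈S [] = zero∈
    evalP-closed β∈S (a∈S ∷ u∈S) = +∈ a∈S (*∈ β∈S (evalP-closed β∈S u∈S))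

  lowerCoeffs : ℕ → Poly → List Carrier
  lowerCoeffs zero p = []
  lowerCoeffs (suc d) p = coeff 0 p ∷ lowerCoeffs d (List.drop 1 p)

  coeff-drop : ∀ j p → coeff (suc j) p ≡ coeff j (List.drop 1 p)
  coeff-drop j [] = ≡.refl
  coeff-drop j (a ∷ p) = ≡.refl

  length-lowerCoeffs : ∀ d p → length (lowerCoeffs d p) ≡ d
  length-lowerCoeffs zero p = ≡.refl
  length-lowerCoeffs (suc d) p = ≡.cong suc (length-lowerCoeffs d (List.drop 1 p))

  lowerCoeffs-closed : ∀ {S : Pred Carrier ℓ} d p → (∀ j → j < d → S (coeff j p)) → All S (lowerCoeffs d p)
  lowerCoeffs-closed zero p _ = []
  lowerCoeffs-closed {S} (suc d) p p∈S = p∈S 0 (s≤s z≤n) ∷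
    lowerCoeffs-closed d (List.drop 1 p) (λ j j<d → ≡.subst S (coeff-drop j p) (p∈S (suc j) (s≤s j<d)))

  evalP-split : ∀ p x → evalP p x ≈ coeff 0 p + x * evalP (List.drop 1 p) x
  evalP-split [] x = sym (trans (+-congˡ (zeroʳ x)) (+-identityʳ _))
  evalP-split (a ∷ p) x = refl

  evalP-Deg<0 : ∀ p x → Deg< p 0 → evalP p x ≈ 0#
  evalP-Deg<0 [] x _ = refl
  evalP-Deg<0 (a ∷ p) x p<0 = trans (+-cong (p<0 0 z≤n) (trans (*-congˡ (evalP-Deg<0 p x (λ j _ → p<0 (suc j) z≤n))) (zeroʳ x)))
    (+-identityˡ _)

  evalP-monic : ∀ d p x → Deg< p (suc d) → coeff d p ≈ 1# → evalP p x ≈ evalMonic (lowerCoeffs d p) x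
  evalP-monic zero p x p<1 p₀≈1 = trans (evalP-split p x) (trans (+-cong p₀≈1 (trans (*-congˡ
    (evalP-Deg<0 (List.drop 1 p) x (λ j _ → trans (reflexive (≡.sym (coeff-drop j p))) (p<1 (suc j) (s≤s z≤n))))) (zeroʳ x)))
    (+-identityʳ _))
  evalP-monic (suc d) p x p< pd≈1 = trans (evalP-split p x) (+-congˡ (*-congˡ (evalP-monic d (List.drop 1 p) x
    (λ j d<j → trans (reflexive (≡.sym (coeff-drop j p))) (p< (suc j) (s≤s d<j)))
    (trans (reflexive (≡.sym (coeff-drop d p))) pd≈1))))

  data CharEntry {n} (A : Matrix n) (i j : Fin n) : Poly → Set (c ⊔ ℓ) where
    diagonal : i ≡ j → CharEntry A i j (Xp +P negP (constP (A i j)))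
    off-diagonal : i ≢ j → CharEntry A i j ([] +P negP (constP (A i j)))

  charMatrix : ∀ {n} (A : Matrix n) → Fin n → Fin n → Poly
  charMatrix {n} A = proj₁ charPoly≡det
    where
    charPoly≡det : Σ (Fin n → Fin n → Poly) λ m → charPoly A ≡ det n m
    charPoly≡det = _ , ≡.refl

  charEntry : ∀ {n} (A : Matrix n) i j → CharEntry A i j (charMatrix A i j)
  charEntry A i j with i Fin.≟ j
  ... | yes i≡j = diagonal i≡j
  ... | no i≢j = off-diagonal i≢j

  CharEntry-shape : ∀ {n} {A : Matrix n} {i j p} → CharEntry A i j p →
                    Deg< p 2 × (i ≡ j → coeff 1 p ≈ 1#) × (i ≢ j → Deg< p 1)
  CharEntry-shape (diagonal i≡j) =
    (λ { (suc zero) (s≤s ()) ; (suc (suc _)) _ → refl }) , (λ _ → refl) , (λ i≢j → contradiction i≡j i≢j)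
  CharEntry-shape (off-diagonal i≢j) =
    (λ { (suc _) _ → refl }) , (λ i≡j → contradiction i≡j i≢j) , (λ _ → λ { (suc _) _ → refl })

  CharEntry-closed : ∀ {S} → IsSubfield S → ∀ {n} {A : Matrix n} {i j p} → S (A i j) → CharEntry A i j p → All S p
  CharEntry-closed S-subfield Aij∈S (diagonal _) = +∈ zero∈ (*∈ (neg∈ one∈) Aij∈S) ∷ one∈ ∷ []
    where open IsSubfield S-subfield
  CharEntry-closed S-subfield Aij∈S (off-diagonal _) = *∈ (neg∈ one∈) Aij∈S ∷ []
    where open IsSubfield S-subfield

  evalP-CharEntry-diagonal : ∀ {n} {A : Matrix n} {i p} x → CharEntry A i i p → evalP p x ≈ x - A i i
  evalP-CharEntry-diagonal x (off-diagonal i≢i) = contradiction ≡.refl i≢i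
  evalP-CharEntry-diagonal {A = A} {i} x (diagonal _) = begin
    (0# + - 1# * A i i) + x * (1# + x * 0#)   ≈⟨ +-cong (trans (+-identityˡ _) (-1*x≈-x _))
                                                        (*-congˡ (trans (+-congˡ (zeroʳ x)) (+-identityʳ _))) ⟩
    - A i i + x * 1#                          ≈⟨ trans (+-comm _ _) (+-congʳ (*-identityʳ x)) ⟩
    x - A i i                                 ∎

  evalP-CharEntry-off : ∀ {n} {A : Matrix n} {i j p} x → i ≢ j → CharEntry A i j p → evalP p x ≈ - A i j
  evalP-CharEntry-off x i≢j (diagonal i≡j) = contradiction i≡j i≢j
  evalP-CharEntry-off x _ (off-diagonal _) = trans (+-cong (-1*x≈-x _) (zeroʳ x)) (+-identityʳ _)

  module _ {n : ℕ} (A : Matrix n) where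
    charPoly-Deg< : Deg< (charPoly A) (suc n)
    charPoly-Deg< = det-Deg< n (charMatrix A) (λ i j → proj₁ (CharEntry-shape (charEntry A i j)))

    charPoly-monic : coeff n (charPoly A) ≈ 1#
    charPoly-monic = det-monic n (charMatrix A) (λ i j → CharEntry-shape (charEntry A i j))

    charPoly-closed : ∀ {S} → IsSubfield S → (∀ i j → S (A i j)) → All S (charPoly A)
    charPoly-closed S-subfield A∈S = PolyClosure.det-closed S-subfield n (charMatrix A)
      (λ i j → CharEntry-closed S-subfield (A∈S i j) (charEntry A i j))

    symFun-closed : ∀ {S} → IsSubfield S → (∀ i j → S (A i j)) → ∀ k → S (symFun A k)
    symFun-closed S-subfield A∈S k =
      sign-closed S-subfield k (PolyClosure.coeff-closed S-subfield (n ∸ k) (charPoly-closed S-subfield A∈S))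

    coeff-charPoly-closed : ∀ {S} → IsSubfield S → (∀ (k : Fin n) → S (symFun A (suc (toℕ k)))) →
                            ∀ j → j < n → S (coeff j (charPoly A))
    coeff-charPoly-closed {S} S-subfield symFun∈S j j<n with complement-index n j j<n
    ... | k , 1+k≡n-j = IsSubfield.resp S-subfield (begin
      sign (n ∸ j) (sign (n ∸ j) (coeff (n ∸ (n ∸ j)) (charPoly A)))   ≈⟨ sign-involutive (n ∸ j) _ ⟩
      coeff (n ∸ (n ∸ j)) (charPoly A)
        ≡⟨ ≡.cong (λ m → coeff m (charPoly A)) (ℕ.m∸[m∸n]≡n (ℕ.<⇒≤ j<n)) ⟩
      coeff j (charPoly A)                                              ∎)
      (sign-closed S-subfield (n ∸ j) (≡.subst (λ m → S (symFun A m)) 1+k≡n-j (symFun∈S k)))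

  -- b is a left eigenvector of A for α, so b is in the left kernel of α·I − A.
  charPoly-root : ∀ {d} (A : Matrix (suc d)) (b : Fin (suc d) → Carrier) α → b Fin.zero ≉ 0# →
                  (∀ j → α * b j ≈ sumF (λ i → A i j * b i)) → evalP (charPoly A) α ≈ 0#
  charPoly-root {d} A b α b₀≉0 eigen = trans (evalP-det (suc d) (charMatrix A) α) (Det-singular d N b b₀≉0 left-kernel)
    where
    N : Matrix (suc d)
    N i j = evalP (charMatrix A i j) α
    left-kernel : ∀ j → sumF (λ i → b i * N i j) ≈ 0#
    left-kernel j = begin
      sumF (λ i → b i * N i j)                   ≈⟨ sumF-cong (λ i → solve 3 (λ b n a → b :* n := (b :* n :+ a :* b) :- a :* b)
                                                      refl (b i) (N i j) (A i j)) ⟩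
      sumF (λ i → g i - A i j * b i)             ≈⟨ sumF-+ g (λ i → - (A i j * b i)) ⟩
      sumF g + sumF (λ i → - (A i j * b i))      ≈⟨ +-cong (sumF-δ g j g-off) (sym (-‿distrib-sumF (λ i → A i j * b i))) ⟩
      g j - sumF (λ i → A i j * b i)             ≈⟨ +-cong g-on (-‿cong (sym (eigen j))) ⟩
      α * b j - α * b j                          ≈⟨ -‿inverseʳ _ ⟩
      0#                                         ∎
      where
      g : Fin (suc d) → Carrier
      g i = b i * N i j + A i j * b i
      g-off : ∀ i → i ≢ j → g i ≈ 0#
      g-off i i≢j = trans (+-congʳ (*-congˡ (evalP-CharEntry-off α i≢j (charEntry A i j))))
        (solve 2 (λ b a → b :* (:- a) :+ a :* b := con (ℤ.+ 0)) refl (b i) (A i j))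
      g-on : g j ≈ α * b j
      g-on = trans (+-congʳ (*-congˡ (evalP-CharEntry-diagonal α (charEntry A j j))))
        (solve 3 (λ b x a → b :* (x :- a) :+ a :* b := x :* b) refl (b j) α (A j j))

  -- Bases

  lincomb-tabulate : ∀ {m} (b : Fin m → Carrier) t → lincomb t (List.tabulate b) ≈ sumF (λ i → coeff (toℕ i) t * b i)
  lincomb-tabulate {zero} b [] = refl
  lincomb-tabulate {zero} b (a ∷ t) = refl
  lincomb-tabulate {suc m} b [] = sym (sumF-≈0 (λ i → coeff (toℕ i) [] * b i) (λ i → zeroˡ (b i)))
  lincomb-tabulate {suc m} b (a ∷ t) = +-congˡ (lincomb-tabulate (b ∘ Fin.suc) t)

  coeff-tabulate : ∀ {m} (a : Fin m → Carrier) (i : Fin m) → coeff (toℕ i) (List.tabulate a) ≡ a i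
  coeff-tabulate a Fin.zero = ≡.refl
  coeff-tabulate a (Fin.suc i) = coeff-tabulate (a ∘ Fin.suc) i

  coeff-≈⇒≋ : ∀ {m} t t′ → length t ≡ m → length t′ ≡ m →
              (∀ (i : Fin m) → coeff (toℕ i) t ≈ coeff (toℕ i) t′) → t ≋ t′
  coeff-≈⇒≋ [] [] _ _ _ = []
  coeff-≈⇒≋ [] (_ ∷ _) |t|≡ |t′|≡ _ = contradiction (≡.trans |t|≡ (≡.sym |t′|≡)) λ ()
  coeff-≈⇒≋ (_ ∷ _) [] |t|≡ |t′|≡ _ = contradiction (≡.trans |t|≡ (≡.sym |t′|≡)) λ ()
  coeff-≈⇒≋ {suc m} (a ∷ t) (a′ ∷ t′) |t|≡ |t′|≡ coeffs≈ =
    coeffs≈ Fin.zero ∷ coeff-≈⇒≋ t t′ (ℕ.suc-injective |t|≡) (ℕ.suc-injective |t′|≡) (coeffs≈ ∘ Fin.suc)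

  module Basis {S : Pred Carrier ℓ} (S-subfield : IsSubfield S) {n} (b : Fin n → Carrier) (basis : IsBasis S b) where
    open IsSubfield S-subfield hiding (resp)
    open IsSubfield S-subfield using () renaming (resp to S-resp)

    coords : Carrier → Fin n → Carrier
    coords x = proj₁ (proj₁ basis x)

    coords∈S : ∀ x i → S (coords x i)
    coords∈S x = proj₁ (proj₂ (proj₁ basis x))

    coords-spec : ∀ x → x ≈ sumF (λ i → coords x i * b i)
    coords-spec x = proj₂ (proj₂ (proj₁ basis x))

    sumF-difference : ∀ (a e : Fin n → Carrier) →
                      sumF (λ i → (a i - e i) * b i) ≈ sumF (λ i → a i * b i) - sumF (λ i → e i * b i)
    sumF-difference a e = trans (sumF-cong (λ i → trans (distribʳ (b i) (a i) (- e i)) (+-congˡ (sym (-‿distribˡ-* (e i) (b i))))))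
      (trans (sumF-+ (λ i → a i * b i) (λ i → - (e i * b i))) (+-congˡ (sym (-‿distrib-sumF (λ i → e i * b i)))))

    coords-unique : ∀ (a e : Fin n → Carrier) → (∀ i → S (a i)) → (∀ i → S (e i)) →
                    sumF (λ i → a i * b i) ≈ sumF (λ i → e i * b i) → ∀ i → a i ≈ e i
    coords-unique a e a∈S e∈S sums≈ i = x∙y⁻¹≈ε⇒x≈y (a i) (e i) (proj₂ basis (λ i → a i - e i)
      (λ i → +∈ (a∈S i) (neg∈ (e∈S i))) (trans (sumF-difference a e) (x≈y⇒x∙y⁻¹≈ε sums≈)) i)

    ∈S⇒coords : ∀ {x} → S x → ∀ i → coords x i ≈ x * coords 1# i
    ∈S⇒coords {x} x∈S = coords-unique (coords x) (λ i → x * coords 1# i) (coords∈S x) (λ i → *∈ x∈S (coords∈S 1# i)) (begin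
      sumF (λ i → coords x i * b i)          ≈⟨ coords-spec x ⟨
      x                                      ≈⟨ *-identityʳ x ⟨
      x * 1#                                 ≈⟨ *-congˡ (coords-spec 1#) ⟩
      x * sumF (λ i → coords 1# i * b i)     ≈⟨ *-distribˡ-sumF x (λ i → coords 1# i * b i) ⟩
      sumF (λ i → x * (coords 1# i * b i))   ≈⟨ sumF-cong (λ i → *-assoc x (coords 1# i) (b i)) ⟨
      sumF (λ i → x * coords 1# i * b i)     ∎)

    -- Some coordinate of 1 is a nonzero element of S, and x is that coordinate of x divided by it.
    coords⇒∈S : ∀ {x} → (∀ i → coords x i ≈ x * coords 1# i) → S x
    coords⇒∈S {x} coords≈ with Fin.any? (λ i → ¬? (coords 1# i ≟ 0#))
    ... | yes (i , c≉0) = let c⁻¹ , cc⁻¹≈1 = inverse (coords 1# i) c≉0 in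
      S-resp (begin
        coords x i * c⁻¹          ≈⟨ *-congʳ (coords≈ i) ⟩
        x * coords 1# i * c⁻¹     ≈⟨ *-assoc _ _ _ ⟩
        x * (coords 1# i * c⁻¹)   ≈⟨ *-congˡ cc⁻¹≈1 ⟩
        x * 1#                    ≈⟨ *-identityʳ x ⟩
        x                         ∎)
        (*∈ (coords∈S x i) (inv∈ (coords∈S 1# i) cc⁻¹≈1))
    ... | no all≈0 = contradiction (trans (coords-spec 1#)
      (sumF-≈0 (λ i → coords 1# i * b i) (λ i → trans (*-congʳ (coord≈0 i)) (zeroˡ (b i))))) 1≉0
      where
      coord≈0 : ∀ i → coords 1# i ≈ 0#
      coord≈0 i with coords 1# i ≟ 0#
      ... | yes c≈0 = c≈0
      ... | no c≉0 = contradiction (i , c≉0) all≈0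

    decSubset : DecSubset
    decSubset = record
      { P = S
      ; P? = λ x → Dec.map′ coords⇒∈S ∈S⇒coords (Fin.all? (λ i → coords x i ≟ (x * coords 1# i)))
      ; resp = S-resp
      }

    basis-≉0 : ∀ i → b i ≉ 0#
    basis-≉0 i bᵢ≈0 = 1≉0 (trans (sym δ-at) (proj₂ basis δ δ∈S
      (trans (sumF-δ (λ j → δ j * b j) i off-i) (trans (*-congʳ δ-at) (trans (*-identityˡ _) bᵢ≈0))) i))
      where
      δ : Fin n → Carrier
      δ j = if does (j Fin.≟ i) then 1# else 0#
      δ∈S : ∀ j → S (δ j)
      δ∈S j with j Fin.≟ i
      ... | yes _ = one∈
      ... | no _ = zero∈
      δ-at : δ i ≈ 1#
      δ-at with i Fin.≟ i
      ... | yes _ = refl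
      ... | no i≢i = contradiction ≡.refl i≢i
      off-i : ∀ j → j ≢ i → δ j * b j ≈ 0#
      off-i j j≢i with j Fin.≟ i
      ... | yes j≡i = contradiction j≡i j≢i
      ... | no _ = zeroˡ (b j)

    order≡∣S∣^n : order ≡ ∣ decSubset ∣ ℕ.^ n
    order≡∣S∣^n = ≡.trans (basis⇒∣∣≡ everything bs independent (λ _ → tt) spanning)
      (≡.cong (∣ decSubset ∣ ℕ.^_) (ListP.length-tabulate b))
      where
      open Span decSubset S-subfield
      open PolyClosure S-subfield using (coeff-closed)
      bs : List Carrier
      bs = List.tabulate b
      independent : Independent bs
      independent {t} {t′} (|t|≡ , t∈S) (|t′|≡ , t′∈S) lincombs≈ =
        coeff-≈⇒≋ t t′ (≡.trans |t|≡ (ListP.length-tabulate b)) (≡.trans |t′|≡ (ListP.length-tabulate b))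
          (coords-unique (λ i → coeff (toℕ i) t) (λ i → coeff (toℕ i) t′)
            (λ i → coeff-closed (toℕ i) t∈S) (λ i → coeff-closed (toℕ i) t′∈S)
            (trans (sym (lincomb-tabulate b t)) (trans lincombs≈ (lincomb-tabulate b t′))))
      spanning : ∀ {x} → ⊤ → x ∈ span bs
      spanning {x} _ = ∈.∈-resp-≈ setoid (sym x≈)
        (∈-span⁺ bs (≡.trans (ListP.length-tabulate (coords x)) (≡.sym (ListP.length-tabulate b)) , All.tabulate⁺ (coords∈S x)))
        where
        x≈ : x ≈ lincomb (List.tabulate (coords x)) bs
        x≈ = trans (coords-spec x) (sym (trans (lincomb-tabulate b (List.tabulate (coords x)))
          (sumF-cong (λ i → *-congʳ (reflexive (coeff-tabulate (coords x) i))))))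

  -- Simple extensions

  -- Membership up to ≈ at the level of ≈, so that it can define a Pred Carrier ℓ.
  _≈∈_ : Carrier → List Carrier → Set ℓ
  x ≈∈ [] = ⊥
  x ≈∈ (y ∷ ys) = x ≈ y ⊎ x ≈∈ ys

  ≈∈⇒∈ : ∀ {x} ys → x ≈∈ ys → x ∈ ys
  ≈∈⇒∈ (y ∷ ys) (inj₁ x≈y) = here x≈y
  ≈∈⇒∈ (y ∷ ys) (inj₂ x≈∈ys) = there (≈∈⇒∈ ys x≈∈ys)

  ∈⇒≈∈ : ∀ {x ys} → x ∈ ys → x ≈∈ ys
  ∈⇒≈∈ (here x≈y) = inj₁ x≈y
  ∈⇒≈∈ (there x∈ys) = inj₂ (∈⇒≈∈ x∈ys)

  _≈∈?_ : ∀ x ys → Dec (x ≈∈ ys)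
  x ≈∈? [] = no λ ()
  x ≈∈? (y ∷ ys) = x ≟ y ⊎-dec x ≈∈? ys

  powers : Carrier → ℕ → List Carrier
  powers x zero = []
  powers x (suc e) = 1# ∷ List.map (x *_) (powers x e)

  length-powers : ∀ x n → length (powers x n) ≡ n
  length-powers x zero = ≡.refl
  length-powers x (suc n) = ≡.cong suc (≡.trans (ListP.length-map _ (powers x n)) (length-powers x n))

  lincomb-map-*ʳ : ∀ t vs x → lincomb t (List.map (x *_) vs) ≈ x * lincomb t vs
  lincomb-map-*ʳ [] vs x = sym (zeroʳ x)
  lincomb-map-*ʳ (a ∷ t) [] x = sym (zeroʳ x)
  lincomb-map-*ʳ (a ∷ t) (v ∷ vs) x = trans (+-congˡ (lincomb-map-*ʳ t vs x))
    (solve 4 (λ a x v y → a :* (x :* v) :+ x :* y := x :* (a :* v :+ y)) refl a x v _)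

  evalP≈lincomb-powers : ∀ t x → evalP t x ≈ lincomb t (powers x (length t))
  evalP≈lincomb-powers [] x = refl
  evalP≈lincomb-powers (a ∷ t) x = +-cong (sym (*-identityʳ a))
    (trans (*-congˡ (evalP≈lincomb-powers t x)) (sym (lincomb-map-*ʳ t (powers x (length t)) x)))

  evalP-∷ʳ : ∀ w z x → evalP (w List.∷ʳ z) x ≈ evalP w x + x ^ length w * z
  evalP-∷ʳ [] z x = trans (+-congˡ (zeroʳ x)) (trans (+-identityʳ z) (sym (trans (+-identityˡ _) (*-identityˡ z))))
  evalP-∷ʳ (a ∷ w) z x = trans (+-congˡ (*-congˡ (evalP-∷ʳ w z x)))
    (solve 5 (λ a x e p z → a :+ x :* (e :+ p :* z) := (a :+ x :* e) :+ (x :* p) :* z) refl a x _ _ z)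

  evalMonic-split : ∀ cs x → evalMonic cs x ≈ evalP cs x + x ^ length cs
  evalMonic-split [] x = sym (+-identityˡ _)
  evalMonic-split (a ∷ cs) x = trans (+-congˡ (*-congˡ (evalMonic-split cs x)))
    (solve 4 (λ a x e p → a :+ x :* (e :+ p) := (a :+ x :* e) :+ x :* p) refl a x _ _)

  length-+P : ∀ p q → length p ≡ length q → length (p +P q) ≡ length p
  length-+P [] [] _ = ≡.refl
  length-+P (a ∷ p) (b ∷ q) |p|≡|q| = ≡.cong suc (length-+P p q (ℕ.suc-injective |p|≡|q|))

  length-scaleP : ∀ a p → length (scaleP a p) ≡ length p
  length-scaleP a [] = ≡.refl
  length-scaleP a (b ∷ p) = ≡.cong suc (length-scaleP a p)

  x^order≈x : ∀ x → x ^ order ≈ x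
  x^order≈x x = SubfieldFermat.x^∣E∣≈x everything everything-subfield tt

  order-2+ : ∃ λ k → order ≡ suc (suc k)
  order-2+ with order | subfield-∣∣≥2 everything everything-subfield
  ... | suc (suc k) | _ = k , ≡.refl
  ... | suc zero | s≤s ()

  inverse≈power : ∃ λ k → ∀ {x y} → x * y ≈ 1# → y ≈ x ^ k
  inverse≈power = let k , order≡2+k = order-2+ in k , λ {x} {y} xy≈1 →
    let x≉0 : x ≉ 0#
        x≉0 x≈0 = 0≉1 (trans (sym (trans (*-congʳ x≈0) (zeroˡ y))) xy≈1)
        x^[1+k]≈1 : x * x ^ k ≈ 1#
        x^[1+k]≈1 = *-cancelˡ-≉0 x≉0 (trans (≡.subst (λ m → x ^ m ≈ x) order≡2+k (x^order≈x x)) (sym (*-identityʳ x)))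
    in begin
      y                   ≈⟨ *-identityʳ y ⟨
      y * 1#              ≈⟨ *-congˡ x^[1+k]≈1 ⟨
      y * (x * x ^ k)     ≈⟨ *-assoc y x _ ⟨
      (y * x) * x ^ k     ≈⟨ *-congʳ (trans (*-comm y x) xy≈1) ⟩
      1# * x ^ k          ≈⟨ *-identityˡ _ ⟩
      x ^ k               ∎

  -- K(β), for β a root of a monic polynomial with coefficients cs in K, is spanned over K by 1, β, …, β ^ (length cs − 1).
  module SimpleExtension (K : DecSubset) (K-subfield : IsSubfield (P K)) (β : Carrier)
                         (cs : List Carrier) (cs∈K : All (P K) cs) (β-root : evalMonic cs β ≈ 0#) where
    open IsSubfield K-subfield hiding (resp)
    open PolyClosure K-subfield
    open Span K K-subfield

    e : ℕ
    e = length cs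

    β^e≈ : β ^ e ≈ - evalP cs β
    β^e≈ = +-inverseʳ-unique _ _ (trans (sym (evalMonic-split cs β)) β-root)

    Reduced : Poly → Set (c ⊔ ℓ)
    Reduced u = ∃ λ t → (length t ≡ e × All (P K) t) × evalP u β ≈ evalP t β

    reduce-top : ∀ w → length w ≡ suc e → All (P K) w → Reduced w
    reduce-top w |w|≡1+e w∈K with List.initLast w
    ... | [] = contradiction |w|≡1+e λ ()
    ... | w′ ∷ʳ′ z = w′ +P scaleP (- z) cs , (|t|≡e , +P-closed w′∈K (scaleP-closed (neg∈ z∈K) cs∈K)) , (begin
      evalP (w′ List.∷ʳ z) β                  ≈⟨ evalP-∷ʳ w′ z β ⟩
      evalP w′ β + β ^ length w′ * z         ≈⟨ +-congˡ (*-congʳ (trans (reflexive (≡.cong (β ^_) |w′|≡e)) β^e≈)) ⟩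
      evalP w′ β + - evalP cs β * z          ≈⟨ +-congˡ (solve 2 (λ p z → :- p :* z := :- z :* p) refl (evalP cs β) z) ⟩
      evalP w′ β + - z * evalP cs β          ≈⟨ +-congˡ (evalP-scaleP (- z) cs β) ⟨
      evalP w′ β + evalP (scaleP (- z) cs) β ≈⟨ evalP-+P w′ (scaleP (- z) cs) β ⟨
      evalP (w′ +P scaleP (- z) cs) β        ∎)
      where
      |w′|≡e : length w′ ≡ e
      |w′|≡e = ℕ.suc-injective (≡.trans (≡.trans (ℕ.+-comm 1 (length w′)) (≡.sym (ListP.length-++ w′))) |w|≡1+e)
      w′∈K : All (P K) w′
      w′∈K = proj₁ (All.++⁻ w′ w∈K)
      z∈K : P K z
      z∈K = All.head (proj₂ (All.++⁻ w′ w∈K))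
      |t|≡e : length (w′ +P scaleP (- z) cs) ≡ e
      |t|≡e = ≡.trans (length-+P w′ _ (≡.trans |w′|≡e (≡.sym (length-scaleP (- z) cs)))) |w′|≡e

    reduce : ∀ u → All (P K) u → Reduced u
    reduce [] [] = List.replicate e 0# , (ListP.length-replicate e , All.replicate⁺ e zero∈) , sym (evalP-zeros e)
      where
      evalP-zeros : ∀ n → evalP (List.replicate n 0#) β ≈ 0#
      evalP-zeros zero = refl
      evalP-zeros (suc n) = trans (+-congˡ (trans (*-congˡ (evalP-zeros n)) (zeroʳ β))) (+-identityʳ _)
    reduce (a ∷ u) (a∈K ∷ u∈K) =
      let t , (|t|≡e , t∈K) , u≈t = reduce u u∈K
          t′ , coeffs , at≈t′ = reduce-top (a ∷ t) (≡.cong suc |t|≡e) (a∈K ∷ t∈K)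
      in t′ , coeffs , trans (+-congˡ (*-congˡ u≈t)) at≈t′

    Adjoin : DecSubset
    Adjoin = record
      { P = _≈∈ span (powers β e)
      ; P? = _≈∈? span (powers β e)
      ; resp = λ x≈y x∈ → ∈⇒≈∈ (∈.∈-resp-≈ setoid x≈y (≈∈⇒∈ _ x∈))
      }

    Adjoin-intro : ∀ {x} u → All (P K) u → x ≈ evalP u β → P Adjoin x
    Adjoin-intro {x} u u∈K x≈u = let t , (|t|≡e , t∈K) , u≈t = reduce u u∈K in ∈⇒≈∈ (∈.∈-resp-≈ setoid
      (sym (trans x≈u (trans u≈t (trans (evalP≈lincomb-powers t β) (reflexive (≡.cong (λ m → lincomb t (powers β m)) |t|≡e))))))
      (∈-span⁺ (powers β e) (≡.trans |t|≡e (≡.sym (length-powers β e)) , t∈K)))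

    Adjoin-elim : ∀ {x} → P Adjoin x → ∃ λ u → All (P K) u × x ≈ evalP u β
    Adjoin-elim {x} x∈ = let t , (|t|≡ , t∈K) , x≈ = ∈-span⁻ (powers β e) (≈∈⇒∈ _ x∈) in
      t , t∈K , trans x≈ (sym (trans (evalP≈lincomb-powers t β) (reflexive (≡.cong (λ m → lincomb t (powers β m))
        (≡.trans |t|≡ (length-powers β e))))))

    Adjoin-subfield : IsSubfield (P Adjoin)
    Adjoin-subfield = record
      { resp = resp Adjoin
      ; zero∈ = Adjoin-intro [] [] refl
      ; one∈ = one∈Adjoin
      ; +∈ = λ x∈ y∈ → let u , u∈K , x≈u = Adjoin-elim x∈ ; v , v∈K , y≈v = Adjoin-elim y∈ in
               Adjoin-intro (u +P v) (+P-closed u∈K v∈K) (trans (+-cong x≈u y≈v) (sym (evalP-+P u v β)))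
      ; neg∈ = λ x∈ → let u , u∈K , x≈u = Adjoin-elim x∈ in
               Adjoin-intro (negP u) (negP-closed u∈K) (trans (-‿cong x≈u) (sym (evalP-negP u β)))
      ; *∈ = *∈Adjoin
      ; inv∈ = λ x∈ xy≈1 → let k , inverse≈^k = inverse≈power in resp Adjoin (sym (inverse≈^k xy≈1)) (^∈Adjoin k x∈)
      }
      where
      one∈Adjoin : P Adjoin 1#
      one∈Adjoin = Adjoin-intro (1# ∷ []) (one∈ ∷ []) (sym (trans (+-congˡ (zeroʳ β)) (+-identityʳ _)))
      *∈Adjoin : ∀ {x y} → P Adjoin x → P Adjoin y → P Adjoin (x * y)
      *∈Adjoin x∈ y∈ = let u , u∈K , x≈u = Adjoin-elim x∈ ; v , v∈K , y≈v = Adjoin-elim y∈ in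
        Adjoin-intro (u *P v) (*P-closed u∈K v∈K) (trans (*-cong x≈u y≈v) (sym (evalP-*P u v β)))
      ^∈Adjoin : ∀ {x} k → P Adjoin x → P Adjoin (x ^ k)
      ^∈Adjoin zero _ = one∈Adjoin
      ^∈Adjoin (suc k) x∈ = *∈Adjoin x∈ (^∈Adjoin k x∈)

    K⊆Adjoin : K ⊆ᴰ Adjoin
    K⊆Adjoin {a} a∈K = Adjoin-intro (a ∷ []) (a∈K ∷ []) (sym (trans (+-congˡ (zeroʳ β)) (+-identityʳ _)))

    β∈Adjoin : P Adjoin β
    β∈Adjoin = Adjoin-intro (0# ∷ 1# ∷ []) (zero∈ ∷ one∈ ∷ [])
      (sym (trans (+-identityˡ _) (trans (*-congˡ (trans (+-congˡ (zeroʳ β)) (+-identityʳ _))) (*-identityʳ β))))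

    Adjoin-minimal : ∀ {T} → IsSubfield T → P K ⊆ T → T β → P Adjoin ⊆ T
    Adjoin-minimal T-subfield K⊆T β∈T x∈ = let u , u∈K , x≈u = Adjoin-elim x∈ in
      IsSubfield.resp T-subfield (sym x≈u) (PolyClosure.evalP-closed T-subfield β∈T (All.map K⊆T u∈K))

    ∣Adjoin∣≤ : ∣ Adjoin ∣ ≤ ∣ K ∣ ℕ.^ e
    ∣Adjoin∣≤ = ≡.subst (λ m → ∣ Adjoin ∣ ≤ ∣ K ∣ ℕ.^ m) (length-powers β e)
      (spanning⇒∣∣≤ Adjoin (powers β e) (≈∈⇒∈ _))

  -- Every element is a root of X ^ order − X, which has coefficients in every subfield.
  module Adjoining (K : DecSubset) (K-subfield : IsSubfield (P K)) (β : Carrier) =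
    SimpleExtension K K-subfield β (fixedPointPoly (proj₁ order-2+)) (fixedPointPoly-closed K-subfield (proj₁ order-2+))
      (trans (evalMonic-fixedPointPoly (proj₁ order-2+) β)
        (x≈y⇒x∙y⁻¹≈ε (≡.subst (λ m → β ^ m ≈ β) (proj₂ order-2+) (x^order≈x β))))

  no-empty-basis : ∀ {S} {b : Fin 0 → Carrier} → ¬ IsBasis S b
  no-empty-basis basis = 1≉0 (proj₂ (proj₂ (proj₁ basis 1#)))

  maximum-of-chain : ∀ {m} (E : Fin (suc m) → DecSubset) → (∀ i j → E i ⊆ᴰ E j ⊎ E j ⊆ᴰ E i) →
                     ∃ λ k → ∀ i → E i ⊆ᴰ E k
  maximum-of-chain {zero} E _ = Fin.zero , λ { Fin.zero x∈ → x∈ }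
  maximum-of-chain {suc m} E chain with maximum-of-chain (E ∘ Fin.suc) (λ i j → chain (Fin.suc i) (Fin.suc j))
  ... | k , E⊆Eₖ with chain Fin.zero (Fin.suc k)
  ... | inj₁ E₀⊆Eₖ = Fin.suc k , λ { Fin.zero x∈ → E₀⊆Eₖ x∈ ; (Fin.suc i) x∈ → E⊆Eₖ i x∈ }
  ... | inj₂ Eₖ⊆E₀ = Fin.zero , λ { Fin.zero x∈ → x∈ ; (Fin.suc i) x∈ → Eₖ⊆E₀ (E⊆Eₖ i x∈) }

  -- α is a root of the characteristic polynomial, a monic polynomial of degree d over F, so F(α), which contains
  -- K(α) = everything, is spanned over F by d powers of α.
  order≤∣F∣^d : ∀ K F → IsSubfield (P F) → K ⊆ᴰ F → ∀ {α} → Generates (P K) α Whole →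
                ∀ {d} (A : Matrix (suc d)) (b : Fin (suc d) → Carrier) → b Fin.zero ≉ 0# →
                (∀ j → α * b j ≈ sumF (λ i → A i j * b i)) → (∀ (k : Fin (suc d)) → P F (symFun A (suc (toℕ k)))) →
                order ≤ ∣ F ∣ ℕ.^ suc d
  order≤∣F∣^d K F F-subfield K⊆F {α} (_ , _ , _ , K[α]-minimal) {d} A b b₀≉0 eigen symFun∈F =
    ℕ.≤-trans (∣∣-mono {everything} {Adjoin} everything⊆F[α])
      (≡.subst (λ m → ∣ Adjoin ∣ ≤ ∣ F ∣ ℕ.^ m) (length-lowerCoeffs (suc d) (charPoly A)) ∣Adjoin∣≤)
    where
    root : evalMonic (lowerCoeffs (suc d) (charPoly A)) α ≈ 0#
    root = trans (sym (evalP-monic (suc d) (charPoly A) α (charPoly-Deg< A) (charPoly-monic A)))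
      (charPoly-root A b α b₀≉0 eigen)
    open SimpleExtension F F-subfield α (lowerCoeffs (suc d) (charPoly A))
      (lowerCoeffs-closed (suc d) (charPoly A) (coeff-charPoly-closed A F-subfield symFun∈F)) root
    everything⊆F[α] : everything ⊆ᴰ Adjoin
    everything⊆F[α] _ = K[α]-minimal (P Adjoin) Adjoin-subfield (K⊆Adjoin ∘ K⊆F) β∈Adjoin tt


lemma1 : ∀ {c ℓ : Level} (M : FiniteField c ℓ) →
         let open FiniteField M using (Carrier) in
         let open Over M in
         (K L : Pred Carrier ℓ) (α : Carrier) →
         IsSubfield K → IsSubfield L → K ⊆ L →
         (∃ λ n → HasDegree K n × IsPrimePower n) →
         Generates K α Whole →
         (d : ℕ) (b : Fin d → Carrier) → IsBasis L b →
         (A : Fin d → Fin d → Carrier) → IsMulMatrix L b α A →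
         ∃ λ (k : Fin d) → Generates K (symFun A (suc (toℕ k))) L
lemma1 M K L α _ _ _ _ _ zero b L-basis _ _ =
  contradiction L-basis (FieldTheory.no-empty-basis M {L} {b})
lemma1 M _ L _ K-subfield L-subfield K⊆L (_ , (b′ , K-basis) , (_ , k , p-prime , n≡p^k)) K[α]≡M (suc d) b L-basis A (A∈L , eigen) =
  kₘ , L-subfield , K⊆L , σ∈L kₘ , λ T T-subfield K⊆T σ∈T → Adjoin-minimal kₘ T-subfield K⊆T σ∈T ∘ L⊆Eₘ
  where
  open Over M
  open FieldTheory M
  open Basis
  K′ L′ : DecSubset
  K′ = decSubset K-subfield b′ K-basis
  L′ = decSubset L-subfield b L-basis
  σ : Fin (suc d) → FiniteField.Carrier M
  σ i = symFun A (suc (toℕ i))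
  σ∈L : ∀ i → L (σ i)
  σ∈L i = symFun-closed A L-subfield A∈L (suc (toℕ i))
  open module K⟨σ⟩ i = Adjoining K′ K-subfield (σ i) using (Adjoin; Adjoin-subfield; K⊆Adjoin; β∈Adjoin; Adjoin-minimal)
  open PrimePowerDegree K′ K-subfield {k = k} (order≡∣S∣^n K-subfield b′ K-basis) p-prime n≡p^k using (intermediate-chain)
  maximum : ∃ λ k → ∀ i → Adjoin i ⊆ᴰ Adjoin k
  maximum = maximum-of-chain Adjoin λ i j →
    intermediate-chain (Adjoin i) (Adjoin j) (Adjoin-subfield i) (Adjoin-subfield j) (K⊆Adjoin i) (K⊆Adjoin j)
  kₘ : Fin (suc d)
  kₘ = proj₁ maximum
  Eₘ : DecSubset
  Eₘ = Adjoin kₘ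
  ∣L∣≤∣Eₘ∣ : ∣ L′ ∣ ≤ ∣ Eₘ ∣
  ∣L∣≤∣Eₘ∣ = ^-cancelʳ-≤ d (≡.subst (_≤ ∣ Eₘ ∣ ℕ.^ suc d) (order≡∣S∣^n L-subfield b L-basis)
    (order≤∣F∣^d K′ Eₘ (Adjoin-subfield kₘ) (K⊆Adjoin kₘ) K[α]≡M A b (basis-≉0 L-subfield b L-basis Fin.zero) eigen
      (λ i → proj₂ maximum i (β∈Adjoin i))))
  L⊆Eₘ : L′ ⊆ᴰ Eₘ
  L⊆Eₘ = ⊆ᴰ∧∣∣≥⇒⊇ᴰ {Eₘ} {L′} (Adjoin-minimal kₘ L-subfield K⊆L (σ∈L kₘ)) ∣L∣≤∣Eₘ∣
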